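{- (a) $\mathcal F:(\mathbb{Q}(\mu_N)\langle\langle\widetilde X\rangle\rangle,\widehat\Delta_{\tilde{\sqcup\!\sqcup}})\to(\mathbb{Q}(\mu_N)\langle\langle X\rangle\rangle,\widehat\Delta_{\sqcup\!\sqcup})$ is a Hopf algebra isomorphism, i.e. in addition to being an algebra isomorphism it satisfies $\widehat\Delta_{\sqcup\!\sqcup}\circ\mathcal F=(\mathcal F\hat\otimes\mathcal F)\circ\widehat\Delta_{\tilde{\sqcup\!\sqcup}}$. (b) $\mathcal F_Y:(\mathbb{Q}(\mu_N)\langle\langle\widetilde Y\rangle\rangle,\widehat\Delta_{\tilde*})\to(\mathbb{Q}(\mu_N)\langle\langle Y\rangle\rangle,\widehat\Delta_*)$ is a Hopf algebra isomorphism, i.e. $\widehat\Delta_*\circ\mathcal F_Y=(\mathcal F_Y\hat\otimes\mathcal F_Y)\circ\widehat\Delta_{\tilde*}$.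
   Context: Let $N\ge3$, $\mu_N$ the $N$-th roots of unity in $\mathbb{C}$, $\zeta_N=\exp(2\pi i/N)$, $\iota:\{1,\dots,N\}\to\mathbb{Z}/N\mathbb{Z}$ the residue bijection. Alphabets $X=\{x_0\}\cup\{x_\zeta:\zeta\in\mu_N\}$, $Y=\{y_{k,\zeta}:k\ge1,\zeta\in\mu_N\}$, $\widetilde X=\{\tilde x\}\cup\{\tilde x_\alpha:\alpha\in\mathbb{Z}/N\mathbb{Z}\}$, $\widetilde Y=\{\tilde y_{k,\alpha}:k\ge1,\alpha\in\mathbb{Z}/N\mathbb{Z}\}$; series algebras have coefficients in $\mathbb{Q}(\mu_N)$. Coproducts (continuous algebra morphisms into completed tensor squares): $\widehat\Delta_{\sqcup\!\sqcup}$ and $\widehat\Delta_{\tilde{\sqcup\!\sqcup}}$ send each letter $u$ of $X$, resp. $\widetilde X$, to $u\otimes1+1\otimes u$; $\widehat\Delta_*(y_{k,\zeta})=y_{k,\zeta}\otimes1+1\otimes y_{k,\zeta}+\sum_{k_1+k_2=k,\,k_i\ge1,\,\zeta_1\zeta_2=\zeta}y_{k_1,\zeta_1}\otimes y_{k_2,\zeta_2}$; $\widehat\Delta_{\tilde*}(\tilde y_{k,\alpha})=\tilde y_{k,\alpha}\otimes1+1\otimes\tilde y_{k,\alpha}+\sum_{k_1+k_2=k,\,k_i\ge1}\tilde y_{k_1,\alpha}\otimes\tilde y_{k_2,\alpha}$. $\mathcal F$ is the continuous $\mathbb{Q}(\mu_N)$-algebra isomorphism $\tilde x\mapsto x_0$,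 $\tilde x_\alpha\mapsto\sum_{m=1}^N\zeta_N^{ -m\iota^{ -1}(\alpha)}x_{\zeta_N^m}$, and $\mathcal F_Y$ is the $\mathbb{Q}(\mu_N)$-algebra isomorphism $\tilde y_{k,\alpha}\mapsto\sum_{m=1}^N\zeta_N^{ -m\iota^{ -1}(\alpha)}y_{k,\zeta_N^m}$. -}

module Defs where

open import Level using (Level)
open import Algebra.Bundles using (CommutativeRing)
open import Data.Nat as ℕ using (ℕ; zero; suc; _∸_; _<_)
open import Data.Nat.DivMod using (_mod_)
open import Data.Fin as Fin using (Fin; toℕ)
open import Data.Bool using (if_then_else_)
open import Data.Product using (_×_; _,_)
open import Data.List using (List; []; _∷_; _++_; map; concatMap; foldr; upTo; allFin; length)
open import Data.Nat.ListAction using (sum)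
import Data.List.Properties as LP
open import Relation.Nullary using (¬_; does; yes; no)
open import Relation.Binary.Definitions using (DecidableEquality)
open import Relation.Binary.PropositionalEquality using (_≡_; refl; cong; cong₂)

module Hopf {c ℓ : Level} (K : CommutativeRing c ℓ) (n : ℕ)
            (ζ : CommutativeRing.Carrier K) where

  open CommutativeRing K hiding (refl; sym; trans)

  N : ℕ
  N = 3 ℕ.+ n

  pow : Carrier → ℕ → Carrier
  pow x zero    = 1#
  pow x (suc k) = x * pow x k

  IsPrimitiveRoot : Set ℓ
  IsPrimitiveRoot = (pow ζ N ≈ 1#) × (∀ j → 0 < j → j < N → ¬ (pow ζ j ≈ 1#))

  -- ζ⁻¹ = ζ^(N-1)  (valid since ζ^N = 1)
  ζ⁻¹ : Carrier
  ζ⁻¹ = pow ζ (N ∸ 1)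

  -- ι⁻¹ : ℤ/Nℤ → {1,…,N}; residues are represented by Fin N
  ιinv : Fin N → ℕ
  ιinv Fin.zero    = N
  ιinv (Fin.suc i) = suc (toℕ i)

  res : ℕ → Fin N
  res m = m mod N

  ΣK : List Carrier → Carrier
  ΣK = foldr _+_ 0#

  -- The root of unity ζ^m ∈ μ_N is represented by m : Fin N.
  -- For Y and Ỹ the index k ≥ 1 is stored as k ∸ 1, i.e.
  --   y k m  stands for  y_{k+1, ζ^m},   ỹ k α  stands for  ỹ_{k+1, α}.

  data LX : Set where
    x₀ : LX
    xζ : Fin N → LX

  data LX̃ : Set where
    x̃  : LX̃
    x̃α : Fin N → LX̃

  data LY : Set where
    y : ℕ → Fin N → LY

  data LỸ : Set where
    ỹ : ℕ → Fin N → LỸ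

  _≟X_ : DecidableEquality LX
  x₀ ≟X x₀ = yes refl
  x₀ ≟X xζ _ = no λ ()
  xζ _ ≟X x₀ = no λ ()
  xζ a ≟X xζ b with a Fin.≟ b
  ... | yes refl = yes refl
  ... | no ne = no λ { refl → ne refl }

  _≟X̃_ : DecidableEquality LX̃
  x̃ ≟X̃ x̃ = yes refl
  x̃ ≟X̃ x̃α _ = no λ ()
  x̃α _ ≟X̃ x̃ = no λ ()
  x̃α a ≟X̃ x̃α b with a Fin.≟ b
  ... | yes refl = yes refl
  ... | no ne = no λ { refl → ne refl }

  _≟Y_ : DecidableEquality LY
  y k a ≟Y y l b with k ℕ.≟ l | a Fin.≟ b
  ... | yes refl | yes refl = yes refl
  ... | no ne | _ = no λ { refl → ne refl }
  ... | _ | no ne = no λ { refl → ne refl }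

  _≟Ỹ_ : DecidableEquality LỸ
  ỹ k a ≟Ỹ ỹ l b with k ℕ.≟ l | a Fin.≟ b
  ... | yes refl | yes refl = yes refl
  ... | no ne | _ = no λ { refl → ne refl }
  ... | _ | no ne = no λ { refl → ne refl }

  -- Noncommutative polynomials (finite linear combinations of words) and
  -- elements of the tensor square of the polynomial algebra.

  Poly : Set → Set c
  Poly A = List (Carrier × List A)

  Poly₂ : Set → Set c
  Poly₂ A = List (Carrier × List A × List A)

  mulP : {A : Set} → Poly A → Poly A → Poly A
  mulP p q = concatMap (λ { (a , u) → map (λ { (b , v) → (a * b , u ++ v) }) q }) p

  mulP₂ : {A : Set} → Poly₂ A → Poly₂ A → Poly₂ A
  mulP₂ p q = concatMap (λ { (a , u , u') →
                map (λ { (b , v , v') → (a * b , u ++ v , u' ++ v') }) q }) p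

  onWord : {A B : Set} → (A → Poly B) → List A → Poly B
  onWord σ = foldr (λ a r → mulP (σ a) r) ((1# , []) ∷ [])

  onWord₂ : {A B : Set} → (A → Poly₂ B) → List A → Poly₂ B
  onWord₂ σ = foldr (λ a r → mulP₂ (σ a) r) ((1# , [] , []) ∷ [])

  coeff : {A : Set} → DecidableEquality A → List A → Poly A → Carrier
  coeff _≟_ w p = ΣK (map (λ { (a , u) → if does (LP.≡-dec _≟_ u w) then a else 0# }) p)

  coeff₂ : {A : Set} → DecidableEquality A → List A → List A → Poly₂ A → Carrier
  coeff₂ _≟_ w w' p = ΣK (map (λ { (a , u , u') →
      if does (LP.≡-dec _≟_ u w) then (if does (LP.≡-dec _≟_ u' w') then a else 0#) else 0# }) p)

  -- Formal power series K⟨⟨A⟩⟩ (coefficient functions on words) and the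
  -- completed tensor square K⟨⟨A⟩⟩ ⊗̂ K⟨⟨A⟩⟩ (coefficient functions on
  -- pairs of words).

  Series : Set → Set c
  Series A = List A → Carrier

  Series₂ : Set → Set c
  Series₂ A = List A → List A → Carrier

  -- Enumeration of the words of a given degree (length for X, X̃;
  -- weight Σ k_i for Y, Ỹ).  All maps below preserve this grading, so the
  -- continuous extension S ↦ Σ_w S_w φ(w) evaluated at a word of degree d
  -- only involves words w of degree d; all other terms vanish.

  wordsLen : {A : Set} → List A → ℕ → List (List A)
  wordsLen L zero    = [] ∷ []
  wordsLen L (suc d) = concatMap (λ a → map (a ∷_) (wordsLen L d)) L

  allX : List LX
  allX = x₀ ∷ map xζ (allFin N)

  allX̃ : List LX̃
  allX̃ = x̃ ∷ map x̃α (allFin N)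

  bump : List ℕ → List (List ℕ)
  bump []      = []
  bump (k ∷ c) = (suc k ∷ c) ∷ []

  comps : ℕ → List (List ℕ)
  comps zero    = [] ∷ []
  comps (suc d) = map (1 ∷_) (comps d) ++ concatMap bump (comps d)

  wordsComp : {A : Set} → (ℕ → Fin N → A) → List ℕ → List (List A)
  wordsComp mk []      = [] ∷ []
  wordsComp mk (k ∷ c) = concatMap (λ m → map (mk (k ∸ 1) m ∷_) (wordsComp mk c)) (allFin N)

  wordsWt : {A : Set} → (ℕ → Fin N → A) → ℕ → List (List A)
  wordsWt mk d = concatMap (wordsComp mk) (comps d)

  wtY : List LY → ℕ
  wtY w = sum (map (λ { (y k _) → suc k }) w)

  wtỸ : List LỸ → ℕ
  wtỸ w = sum (map (λ { (ỹ k _) → suc k }) w)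

  -- Letter images of 𝓕 and 𝓕_Y.
  --   𝓕(x̃) = x₀,  𝓕(x̃_α) = Σ_{m=1}^N ζ^{-m ι⁻¹(α)} x_{ζ^m}
  --   𝓕_Y(ỹ_{k,α}) = Σ_{m=1}^N ζ^{-m ι⁻¹(α)} y_{k,ζ^m}

  oneToN : List ℕ
  oneToN = map suc (upTo N)

  σF : LX̃ → Poly LX
  σF x̃       = (1# , x₀ ∷ []) ∷ []
  σF (x̃α α) = map (λ m → (pow ζ⁻¹ (m ℕ.* ιinv α) , xζ (res m) ∷ [])) oneToN

  σFY : LỸ → Poly LY
  σFY (ỹ k α) = map (λ m → (pow ζ⁻¹ (m ℕ.* ιinv α) , y k (res m) ∷ [])) oneToN

  𝓕 : Series LX̃ → Series LX
  𝓕 S v = ΣK (map (λ w → S w * coeff _≟X_ v (onWord σF w)) (wordsLen allX̃ (length v)))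

  𝓕Y : Series LỸ → Series LY
  𝓕Y S v = ΣK (map (λ w → S w * coeff _≟Y_ v (onWord σFY w)) (wordsWt ỹ (wtY v)))

  𝓕⊗𝓕 : Series₂ LX̃ → Series₂ LX
  𝓕⊗𝓕 T u v = ΣK (map (λ w → ΣK (map (λ w' →
      T w w' * (coeff _≟X_ u (onWord σF w) * coeff _≟X_ v (onWord σF w')))
      (wordsLen allX̃ (length v)))) (wordsLen allX̃ (length u)))

  𝓕Y⊗𝓕Y : Series₂ LỸ → Series₂ LY
  𝓕Y⊗𝓕Y T u v = ΣK (map (λ w → ΣK (map (λ w' →
      T w w' * (coeff _≟Y_ u (onWord σFY w) * coeff _≟Y_ v (onWord σFY w')))
      (wordsWt ỹ (wtY v)))) (wordsWt ỹ (wtY u)))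

  σSh : {A : Set} → A → Poly₂ A
  σSh a = (1# , a ∷ [] , []) ∷ (1# , [] , a ∷ []) ∷ []

  -- pairs (k₁,k₂) of positive integers with k₁ + k₂ = k+1 (k+1 the true
  -- index), returned in the shifted encoding (k₁ ∸ 1 , k₂ ∸ 1)
  splits : ℕ → List (ℕ × ℕ)
  splits zero    = []
  splits (suc k) = map (λ a → (a , k ∸ a)) (upTo (suc k))

  rootPairs : Fin N → List (Fin N × Fin N)
  rootPairs m = concatMap (λ m₁ → concatMap (λ m₂ →
      if does (res (toℕ m₁ ℕ.+ toℕ m₂) Fin.≟ m) then (m₁ , m₂) ∷ [] else [])
      (allFin N)) (allFin N)

  σSt : LY → Poly₂ LY
  σSt (y k m) = σSh (y k m) ++
    concatMap (λ { (k₁ , k₂) → map (λ { (m₁ , m₂) → (1# , y k₁ m₁ ∷ [] , y k₂ m₂ ∷ []) })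
                                   (rootPairs m) }) (splits k)

  σSt̃ : LỸ → Poly₂ LỸ
  σSt̃ (ỹ k α) = σSh (ỹ k α) ++
    map (λ { (k₁ , k₂) → (1# , ỹ k₁ α ∷ [] , ỹ k₂ α ∷ []) }) (splits k)

  Δш : Series LX → Series₂ LX
  Δш S u v = ΣK (map (λ w → S w * coeff₂ _≟X_ u v (onWord₂ σSh w))
                   (wordsLen allX (length u ℕ.+ length v)))

  Δш̃ : Series LX̃ → Series₂ LX̃
  Δш̃ S u v = ΣK (map (λ w → S w * coeff₂ _≟X̃_ u v (onWord₂ σSh w))
                   (wordsLen allX̃ (length u ℕ.+ length v)))

  Δ* : Series LY → Series₂ LY
  Δ* S u v = ΣK (map (λ w → S w * coeff₂ _≟Y_ u v (onWord₂ σSt w))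
                   (wordsWt y (wtY u ℕ.+ wtY v)))

  Δ*̃ : Series LỸ → Series₂ LỸ
  Δ*̃ S u v = ΣK (map (λ w → S w * coeff₂ _≟Ỹ_ u v (onWord₂ σSt̃ w))
                   (wordsWt ỹ (wtỸ u ℕ.+ wtỸ v)))

{-# OPTIONS --safe #-}
module Submission where

open import Level using (_⊔_)
open import Algebra.Bundles using (CommutativeRing)
open import Algebra.Definitions using (Associative; Identity)
open import Data.Bool using (true; false; if_then_else_)
open import Data.Fin as Fin using (Fin)
import Data.Fin.Properties as FinP
open import Data.List using (List; []; _∷_; _++_; _∷ʳ_; map; concatMap; foldr; allFin; length; tabulate; applyUpTo; upTo)
import Data.List.Properties as List
open import Data.List.Relation.Binary.Permutation.Propositional using (_↭_; ↭⇒↭ₛ′; module PermutationReasoning)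
import Data.List.Relation.Binary.Permutation.Propositional.Properties as ↭
import Data.List.Relation.Binary.Permutation.Setoid.Properties as ↭ₛ
open import Data.List.Relation.Unary.All using (All; []; _∷_)
import Data.List.Relation.Unary.All as All
open import Data.List.Relation.Unary.All.Properties using (gmap⁺; concat⁺; map⁺; ++⁺)
open import Data.Nat as ℕ using (ℕ; zero; suc; _∸_)
open import Data.Nat.DivMod using (_mod_)
import Data.Nat.DivMod as DM
open import Data.Nat.ListAction using (sum)
import Data.Nat.Properties as ℕP
open import Data.Product using (_×_; _,_; proj₁; proj₂)
open import Function using (id)
open import Function.Bundles using (_⇔_; mk⇔)
open import Relation.Binary.Definitions using (DecidableEquality)
open import Relation.Binary.PropositionalEquality as ≡ using (_≡_; _≢_)
open import Relation.Nullary using (Dec; does; yes; no; ¬_; contradiction)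
open import Relation.Nullary.Decidable using (does-⇔)

open import Defs

-- Both sides of each identity are continuous algebra morphisms out of a completed free algebra, so
-- everything reduces to letters.  Elements of tensor squares are handled dually, through their
-- pairings with arbitrary functionals: if Δ ∘ 𝓕 and (𝓕 ⊗ 𝓕) ∘ Δ̃ agree on letters, they agree on
-- words because all maps involved are multiplicative.  Passing to series costs nothing since 𝓕 is
-- homogeneous (for the length on X̃, X and the weight Σ kᵢ on Ỹ, Y), so a coefficient only involves
-- the finitely many words of a single degree, and each of those is enumerated exactly once.
-- On letters, (a) holds because 𝓕 sends the primitive letters x̃, x̃_α to linear combinations of
-- primitive letters.  In (b) the extra terms Σ y_{k₁,ζ₁} ⊗ y_{k₂,ζ₂} of Δ_* match those of Δ_{~*}
-- because m ↦ ζ^{-m ι⁻¹(α)} is a character of ℤ/Nℤ: the coefficient of y_{k,ζ₁ζ₂} in 𝓕_Y(ỹ_{k,α})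
-- is the product of those of y_{k₁,ζ₁} and y_{k₂,ζ₂}.  This only needs ζ^N = 1.

module FiniteSums {c ℓ} (K : CommutativeRing c ℓ) where

  open CommutativeRing K
  open import Relation.Binary.Reasoning.Setoid setoid
  open import Algebra.Properties.CommutativeSemigroup +-commutativeSemigroup
    using () renaming (interchange to +-interchange)

  ∑ : ∀ {a} {X : Set a} → List X → (X → Carrier) → Carrier
  ∑ L f = foldr _+_ 0# (map f L)

  syntax ∑ L (λ x → e) = ∑[ x ∈ L ] e

  module _ {a} {X : Set a} where

    ∑-cong : ∀ {f g : X → Carrier} L → (∀ x → f x ≈ g x) → ∑ L f ≈ ∑ L g
    ∑-cong []      f≈g = refl
    ∑-cong (x ∷ L) f≈g = +-cong (f≈g x) (∑-cong L f≈g)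

    ∑-cong-All : ∀ {p} {P : X → Set p} {f g : X → Carrier} {L} →
                 All P L → (∀ {x} → P x → f x ≈ g x) → ∑ L f ≈ ∑ L g
    ∑-cong-All []         f≈g = refl
    ∑-cong-All (px ∷ pxs) f≈g = +-cong (f≈g px) (∑-cong-All pxs f≈g)

    ∑-zero : ∀ {f : X → Carrier} L → (∀ x → f x ≈ 0#) → ∑ L f ≈ 0#
    ∑-zero []      f≈0 = refl
    ∑-zero (x ∷ L) f≈0 = trans (+-cong (f≈0 x) (∑-zero L f≈0)) (+-identityˡ 0#)

    ∑-zero-All : ∀ {p} {P : X → Set p} {f : X → Carrier} {L} → All P L → (∀ {x} → P x → f x ≈ 0#) → ∑ L f ≈ 0#
    ∑-zero-All []         f≈0 = refl
    ∑-zero-All (px ∷ pxs) f≈0 = trans (+-cong (f≈0 px) (∑-zero-All pxs f≈0)) (+-identityˡ 0#)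

    ∑-++ : ∀ (f : X → Carrier) xs ys → ∑ (xs ++ ys) f ≈ ∑ xs f + ∑ ys f
    ∑-++ f []       ys = sym (+-identityˡ _)
    ∑-++ f (x ∷ xs) ys = trans (+-congˡ (∑-++ f xs ys)) (sym (+-assoc _ _ _))

    ∑-distrib-+ : ∀ (f g : X → Carrier) L → ∑[ x ∈ L ] (f x + g x) ≈ ∑ L f + ∑ L g
    ∑-distrib-+ f g []      = sym (+-identityˡ 0#)
    ∑-distrib-+ f g (x ∷ L) = trans (+-congˡ (∑-distrib-+ f g L)) (+-interchange _ _ _ _)

    *-distribˡ-∑ : ∀ a (f : X → Carrier) L → a * ∑ L f ≈ ∑[ x ∈ L ] (a * f x)
    *-distribˡ-∑ a f []      = zeroʳ a
    *-distribˡ-∑ a f (x ∷ L) = trans (distribˡ a _ _) (+-congˡ (*-distribˡ-∑ a f L))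

    *-distribʳ-∑ : ∀ a (f : X → Carrier) L → ∑ L f * a ≈ ∑[ x ∈ L ] (f x * a)
    *-distribʳ-∑ a f []      = zeroˡ a
    *-distribʳ-∑ a f (x ∷ L) = trans (distribʳ a _ _) (+-congˡ (*-distribʳ-∑ a f L))

  module _ {a b} {X : Set a} {Y : Set b} where

    ∑-map : ∀ (f : Y → Carrier) (g : X → Y) L → ∑ (map g L) f ≡ ∑[ x ∈ L ] f (g x)
    ∑-map f g L = ≡.cong (foldr _+_ 0#) (≡.sym (List.map-∘ L))

    ∑-concatMap : ∀ (f : Y → Carrier) (g : X → List Y) L →
                  ∑ (concatMap g L) f ≈ ∑[ x ∈ L ] ∑ (g x) f
    ∑-concatMap f g []      = refl
    ∑-concatMap f g (x ∷ L) = trans (∑-++ f (g x) (concatMap g L)) (+-congˡ (∑-concatMap f g L))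

    ∑-comm : ∀ (f : X → Y → Carrier) L M → ∑[ x ∈ L ] ∑[ y ∈ M ] f x y ≈ ∑[ y ∈ M ] ∑[ x ∈ L ] f x y
    ∑-comm f []      M = sym (∑-zero M (λ _ → refl))
    ∑-comm f (x ∷ L) M = trans (+-congˡ (∑-comm f L M)) (sym (∑-distrib-+ (f x) _ M))

  ∑-↭ : ∀ {a} {X : Set a} (f : X → Carrier) {xs ys} → xs ↭ ys → ∑ xs f ≈ ∑ ys f
  ∑-↭ f xs↭ys = ↭ₛ.foldr-commMonoid setoid +-isCommutativeMonoid (↭⇒↭ₛ′ isEquivalence (↭.map⁺ f xs↭ys))

  𝟙 : ∀ {p} {P : Set p} → Dec P → Carrier
  𝟙 P? = if does P? then 1# else 0#

  𝟙-no : ∀ {p} {P : Set p} (P? : Dec P) → ¬ P → 𝟙 P? ≈ 0#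
  𝟙-no (yes p) ¬p = contradiction p ¬p
  𝟙-no (no _)  ¬p = refl

  𝟙-⇔ : ∀ {p q} {P : Set p} {Q : Set q} → P ⇔ Q → (P? : Dec P) (Q? : Dec Q) → 𝟙 P? ≡ 𝟙 Q?
  𝟙-⇔ P⇔Q P? Q? = ≡.cong (if_then 1# else 0#) (does-⇔ P⇔Q P? Q?)

  𝟙-∷ : ∀ {X : Set} (_≟_ : DecidableEquality X) x y xs ys →
        𝟙 (List.≡-dec _≟_ (x ∷ xs) (y ∷ ys)) ≈ 𝟙 (x ≟ y) * 𝟙 (List.≡-dec _≟_ xs ys)
  𝟙-∷ _≟_ x y xs ys with does (x ≟ y)
  ... | true  = sym (*-identityˡ _)
  ... | false = sym (zeroˡ _)

  module _ {X : Set} (_≟_ : DecidableEquality X) where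

    -- x occurs m times in L, stated as the sifting property of the Kronecker delta at x.
    record Multiplicity (L : List X) (x : X) (m : Carrier) : Set (c ⊔ ℓ) where
      constructor multiplicity
      field sifts : ∀ (g : X → Carrier) → ∑[ y ∈ L ] (𝟙 (x ≟ y) * g y) ≈ m * g x

    open Multiplicity public

    OccursOnce : X → List X → Set (c ⊔ ℓ)
    OccursOnce x L = Multiplicity L x 1#

    multiplicity-cong : ∀ {L x m m'} → m ≈ m' → Multiplicity L x m → Multiplicity L x m'
    multiplicity-cong m≈m' mult = multiplicity λ g → trans (sifts mult g) (*-congʳ m≈m')

    multiplicity-absent : ∀ {L x} → All (x ≢_) L → Multiplicity L x 0#
    multiplicity-absent {x = x} x∉L = multiplicity λ g →
      trans (∑-zero-All x∉L (λ {y} x≢y → trans (*-congʳ (𝟙-no (x ≟ y) x≢y)) (zeroˡ (g y)))) (sym (zeroˡ (g x)))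

    𝟙≟-* : ∀ x y (g : X → Carrier) → 𝟙 (x ≟ y) * g y ≈ 𝟙 (x ≟ y) * g x
    𝟙≟-* x y g with x ≟ y
    ... | yes ≡.refl = refl
    ... | no  _      = trans (zeroˡ _) (sym (zeroˡ _))

    multiplicity-∷ : ∀ {x m} y L → Multiplicity L x m → Multiplicity (y ∷ L) x (𝟙 (x ≟ y) + m)
    multiplicity-∷ {x} {m} y L mult = multiplicity λ g → trans (+-cong (𝟙≟-* x y g) (sifts mult g)) (sym (distribʳ (g x) _ m))

  prefixEach : {X : Set} → List X → List (List X) → List (List X)
  prefixEach L W = concatMap (λ a → map (a ∷_) W) L

  module _ {X : Set} (_≟_ : DecidableEquality X) where

    multiplicity-prefixEach : ∀ {L W a t m m'} → Multiplicity _≟_ L a m → Multiplicity (List.≡-dec _≟_) W t m' →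
                              Multiplicity (List.≡-dec _≟_) (prefixEach L W) (a ∷ t) (m * m')
    multiplicity-prefixEach {L} {W} {a} {t} {m} {m'} mult mult' = multiplicity λ g → begin
      ∑[ w ∈ prefixEach L W ] (𝟙 ((a ∷ t) ≟ʷ w) * g w)
        ≈⟨ ∑-concatMap _ (λ b → map (b ∷_) W) L ⟩
      ∑[ b ∈ L ] ∑ (map (b ∷_) W) (λ w → 𝟙 ((a ∷ t) ≟ʷ w) * g w)
        ≈⟨ ∑-cong L (λ b → reflexive (∑-map _ (b ∷_) W)) ⟩
      ∑[ b ∈ L ] ∑[ w ∈ W ] (𝟙 ((a ∷ t) ≟ʷ (b ∷ w)) * g (b ∷ w))
        ≈⟨ ∑-cong L (λ b → trans (∑-cong W (λ w → trans (*-congʳ (𝟙-∷ _≟_ a b t w)) (*-assoc _ _ _)))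
                                 (sym (*-distribˡ-∑ _ (λ w → 𝟙 (t ≟ʷ w) * g (b ∷ w)) W))) ⟩
      ∑[ b ∈ L ] (𝟙 (a ≟ b) * ∑[ w ∈ W ] (𝟙 (t ≟ʷ w) * g (b ∷ w)))
        ≈⟨ ∑-cong L (λ b → *-congˡ (sifts mult' (λ w → g (b ∷ w)))) ⟩
      ∑[ b ∈ L ] (𝟙 (a ≟ b) * (m' * g (b ∷ t)))
        ≈⟨ sifts mult (λ b → m' * g (b ∷ t)) ⟩
      m * (m' * g (a ∷ t))
        ≈⟨ *-assoc m m' _ ⟨
      (m * m') * g (a ∷ t) ∎
      where _≟ʷ_ = List.≡-dec _≟_

    multiplicity-prefixEach-[] : ∀ L W → Multiplicity (List.≡-dec _≟_) (prefixEach L W) [] 0#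
    multiplicity-prefixEach-[] L W = multiplicity-absent (List.≡-dec _≟_)
      (concat⁺ (map⁺ (All.universal (λ b → map⁺ (All.universal (λ w ()) W)) L)))

  multiplicity-map : ∀ {X Y : Set} (_≟X_ : DecidableEquality X) (_≟Y_ : DecidableEquality Y) {f : X → Y} →
                     (∀ {a b} → f a ≡ f b → a ≡ b) → ∀ L {x m} →
                     Multiplicity _≟X_ L x m → Multiplicity _≟Y_ (map f L) (f x) m
  multiplicity-map _≟X_ _≟Y_ {f} f-injective L {x} {m} mult = multiplicity λ g → begin
    ∑[ z ∈ map f L ] (𝟙 (f x ≟Y z) * g z)      ≡⟨ ∑-map _ f L ⟩
    ∑[ y ∈ L ] (𝟙 (f x ≟Y f y) * g (f y))
      ≈⟨ ∑-cong L (λ y → *-congʳ (reflexive (𝟙-⇔ (mk⇔ f-injective (≡.cong f)) (f x ≟Y f y) (x ≟X y)))) ⟩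
    ∑[ y ∈ L ] (𝟙 (x ≟X y) * g (f y))          ≈⟨ sifts mult (λ y → g (f y)) ⟩
    m * g (f x)                                ∎

  allFin-once : ∀ n (i : Fin n) → OccursOnce Fin._≟_ i (allFin n)
  allFin-once (suc n) i = ≡.subst (λ L → OccursOnce Fin._≟_ i (Fin.zero ∷ L)) (List.map-tabulate id Fin.suc) (once i)
    where
    once : ∀ i → OccursOnce Fin._≟_ i (Fin.zero ∷ map Fin.suc (allFin n))
    once Fin.zero    = multiplicity-cong Fin._≟_ (+-identityʳ 1#) (multiplicity-∷ Fin._≟_ Fin.zero (map Fin.suc (allFin n))
                         (multiplicity-absent Fin._≟_ (map⁺ (All.universal (λ _ ()) (allFin n)))))
    once (Fin.suc i) = multiplicity-cong Fin._≟_ (+-identityˡ 1#) (multiplicity-∷ Fin._≟_ Fin.zero (map Fin.suc (allFin n))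
                         (multiplicity-map Fin._≟_ Fin._≟_ FinP.suc-injective (allFin n) (allFin-once n i)))

module LinearCombinations {c ℓ} (K : CommutativeRing c ℓ) where

  open CommutativeRing K
  open FiniteSums K
  open import Relation.Binary.Reasoning.Setoid setoid
  open import Algebra.Properties.CommutativeSemigroup *-commutativeSemigroup using (x∙yz≈y∙xz)

  LinComb : Set → Set c
  LinComb B = List (Carrier × B)

  ⟨_∣_⟩ : {B : Set} → (B → Carrier) → LinComb B → Carrier
  ⟨ f ∣ p ⟩ = ∑[ t ∈ p ] (proj₁ t * f (proj₂ t))

  module _ {B : Set} where

    ⟨⟩-cong : ∀ {f g : B → Carrier} p → (∀ b → f b ≈ g b) → ⟨ f ∣ p ⟩ ≈ ⟨ g ∣ p ⟩
    ⟨⟩-cong p f≈g = ∑-cong p (λ t → *-congˡ (f≈g (proj₂ t)))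

    ⟨⟩-cong-All : ∀ {P : B → Set} {f g : B → Carrier} {p : LinComb B} →
                  All (λ t → P (proj₂ t)) p → (∀ {b} → P b → f b ≈ g b) → ⟨ f ∣ p ⟩ ≈ ⟨ g ∣ p ⟩
    ⟨⟩-cong-All Pp f≈g = ∑-cong-All Pp (λ Pb → *-congˡ (f≈g Pb))

    ⟨⟩-zero : ∀ {f : B → Carrier} p → (∀ b → f b ≈ 0#) → ⟨ f ∣ p ⟩ ≈ 0#
    ⟨⟩-zero p f≈0 = ∑-zero p (λ t → trans (*-congˡ (f≈0 (proj₂ t))) (zeroʳ _))

    ⟨⟩-*ˡ : ∀ a (f : B → Carrier) p → ⟨ (λ b → a * f b) ∣ p ⟩ ≈ a * ⟨ f ∣ p ⟩
    ⟨⟩-*ˡ a f p = trans (∑-cong p (λ t → x∙yz≈y∙xz _ a _)) (sym (*-distribˡ-∑ a _ p))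

    ⟨⟩-*ʳ : ∀ a (f : B → Carrier) p → ⟨ (λ b → f b * a) ∣ p ⟩ ≈ ⟨ f ∣ p ⟩ * a
    ⟨⟩-*ʳ a f p = trans (∑-cong p (λ t → sym (*-assoc _ _ a))) (sym (*-distribʳ-∑ a _ p))

    ⟨⟩-singleton : ∀ (f : B → Carrier) b → ⟨ f ∣ (1# , b) ∷ [] ⟩ ≈ f b
    ⟨⟩-singleton f b = trans (+-identityʳ _) (*-identityˡ (f b))

    ∑-⟨⟩-comm : ∀ {a} {X : Set a} (f : X → B → Carrier) L p →
                ∑[ x ∈ L ] ⟨ f x ∣ p ⟩ ≈ ⟨ (λ b → ∑[ x ∈ L ] f x b) ∣ p ⟩
    ∑-⟨⟩-comm f L p = trans (∑-comm _ L p) (∑-cong p (λ t → sym (*-distribˡ-∑ (proj₁ t) _ L)))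

  ⟨⟩-comm : ∀ {B C : Set} (f : B → C → Carrier) p q →
            ⟨ (λ b → ⟨ f b ∣ q ⟩) ∣ p ⟩ ≈ ⟨ (λ d → ⟨ (λ b → f b d) ∣ p ⟩) ∣ q ⟩
  ⟨⟩-comm f p q = begin
    ∑[ s ∈ p ] (proj₁ s * ⟨ f (proj₂ s) ∣ q ⟩)                 ≈⟨ ∑-cong p (λ s → sym (⟨⟩-*ˡ (proj₁ s) _ q)) ⟩
    ∑[ s ∈ p ] ⟨ (λ d → proj₁ s * f (proj₂ s) d) ∣ q ⟩         ≈⟨ ∑-⟨⟩-comm _ p q ⟩
    ⟨ (λ d → ⟨ (λ b → f b d) ∣ p ⟩) ∣ q ⟩                      ∎

  ⟨⟩-distrib-+ : ∀ {B : Set} (f g : B → Carrier) p → ⟨ (λ b → f b + g b) ∣ p ⟩ ≈ ⟨ f ∣ p ⟩ + ⟨ g ∣ p ⟩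
  ⟨⟩-distrib-+ f g p = trans (∑-cong p (λ t → distribˡ (proj₁ t) _ _)) (∑-distrib-+ _ _ p)

  letters : ∀ {i} {I : Set i} {B : Set} → List I → (I → Carrier) → (I → B) → LinComb (List B)
  letters L coef letter = map (λ i → (coef i , letter i ∷ [])) L

  ⟨⟩-letters : ∀ {i} {I : Set i} {B : Set} (f : List B → Carrier) L (coef : I → Carrier) letter →
               ⟨ f ∣ letters L coef letter ⟩ ≡ ∑[ i ∈ L ] (coef i * f (letter i ∷ []))
  ⟨⟩-letters f L coef letter = ∑-map _ _ L

  prim : {A : Set} → List A → LinComb (List A × List A)
  prim y = (1# , y , []) ∷ (1# , [] , y) ∷ []

  ⟨⟩-prim : ∀ {A : Set} (f : List A × List A → Carrier) y → ⟨ f ∣ prim y ⟩ ≈ f (y , []) + f ([] , y)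
  ⟨⟩-prim f y = +-cong (*-identityˡ _) (⟨⟩-singleton f ([] , y))

  coefficient : {A : Set} → DecidableEquality A → List A → LinComb (List A) → Carrier
  coefficient _≟_ w p = ∑[ t ∈ p ] (if does (List.≡-dec _≟_ (proj₂ t) w) then proj₁ t else 0#)

  coefficient₂ : {A : Set} → DecidableEquality A → List A → List A → LinComb (List A × List A) → Carrier
  coefficient₂ _≟_ w w' p = ∑[ t ∈ p ]
    (if does (List.≡-dec _≟_ (proj₁ (proj₂ t)) w)
     then (if does (List.≡-dec _≟_ (proj₂ (proj₂ t)) w') then proj₁ t else 0#)
     else 0#)

  module _ {A : Set} (_≟_ : DecidableEquality A) where

    private
      _≟ʷ_ = List.≡-dec _≟_

    δ₂ : List A → List A → List A × List A → Carrier
    δ₂ w w' U = 𝟙 (proj₁ U ≟ʷ w) * 𝟙 (proj₂ U ≟ʷ w')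

    coefficient-pairing : ∀ w p → coefficient _≟_ w p ≈ ⟨ (λ u → 𝟙 (u ≟ʷ w)) ∣ p ⟩
    coefficient-pairing w p = ∑-cong p (λ t → lemma (does (proj₂ t ≟ʷ w)) (proj₁ t))
      where
      lemma : ∀ b a → (if b then a else 0#) ≈ a * (if b then 1# else 0#)
      lemma true  a = sym (*-identityʳ a)
      lemma false a = sym (zeroʳ a)

    coefficient₂-pairing : ∀ w w' p → coefficient₂ _≟_ w w' p ≈ ⟨ δ₂ w w' ∣ p ⟩
    coefficient₂-pairing w w' p =
      ∑-cong p (λ t → lemma (does (proj₁ (proj₂ t) ≟ʷ w)) (does (proj₂ (proj₂ t) ≟ʷ w')) (proj₁ t))
      where
      lemma : ∀ b b' a → (if b then (if b' then a else 0#) else 0#) ≈ a * ((if b then 1# else 0#) * (if b' then 1# else 0#))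
      lemma true  true  a = sym (trans (*-congˡ (*-identityˡ 1#)) (*-identityʳ a))
      lemma true  false a = sym (trans (*-congˡ (zeroʳ 1#)) (zeroʳ a))
      lemma false b'    a = sym (trans (*-congˡ (zeroˡ _)) (zeroʳ a))

  module MonoidAlgebra {B : Set} (_·_ : B → B → B) (ε : B)
                       (·-assoc : Associative _≡_ _·_) (·-identity : Identity _≡_ ε _·_) where

    infixl 7 _⊛_

    _⊛_ : LinComb B → LinComb B → LinComb B
    p ⊛ q = concatMap (λ s → map (λ t → (proj₁ s * proj₁ t , proj₂ s · proj₂ t)) q) p

    ⟨⟩-⊛ : ∀ (f : B → Carrier) p q → ⟨ f ∣ p ⊛ q ⟩ ≈ ⟨ (λ u → ⟨ (λ v → f (u · v)) ∣ q ⟩) ∣ p ⟩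
    ⟨⟩-⊛ f p q = begin
      ⟨ f ∣ p ⊛ q ⟩
        ≈⟨ ∑-concatMap _ _ p ⟩
      ∑[ s ∈ p ] ∑ (map (λ t → (proj₁ s * proj₁ t , proj₂ s · proj₂ t)) q) (λ t → proj₁ t * f (proj₂ t))
        ≈⟨ ∑-cong p (λ s → reflexive (∑-map _ _ q)) ⟩
      ∑[ s ∈ p ] ∑[ t ∈ q ] ((proj₁ s * proj₁ t) * f (proj₂ s · proj₂ t))
        ≈⟨ ∑-cong p (λ s → trans (∑-cong q (λ t → *-assoc _ _ _)) (sym (*-distribˡ-∑ (proj₁ s) _ q))) ⟩
      ⟨ (λ u → ⟨ (λ v → f (u · v)) ∣ q ⟩) ∣ p ⟩ ∎

    extend : {A : Set} → (A → LinComb B) → List A → LinComb B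
    extend σ = foldr (λ a r → σ a ⊛ r) ((1# , ε) ∷ [])

    ⟨⟩-extend-++ : ∀ {A : Set} (σ : A → LinComb B) (f : B → Carrier) x y →
      ⟨ f ∣ extend σ (x ++ y) ⟩ ≈ ⟨ (λ u → ⟨ (λ v → f (u · v)) ∣ extend σ y ⟩) ∣ extend σ x ⟩
    ⟨⟩-extend-++ σ f [] y = sym (trans (⟨⟩-singleton (λ u → ⟨ (λ v → f (u · v)) ∣ extend σ y ⟩) ε)
      (⟨⟩-cong (extend σ y) (λ v → reflexive (≡.cong f (proj₁ ·-identity v)))))
    ⟨⟩-extend-++ σ f (a ∷ x) y = begin
      ⟨ f ∣ σ a ⊛ extend σ (x ++ y) ⟩
        ≈⟨ ⟨⟩-⊛ f (σ a) _ ⟩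
      ⟨ (λ u → ⟨ (λ v → f (u · v)) ∣ extend σ (x ++ y) ⟩) ∣ σ a ⟩
        ≈⟨ ⟨⟩-cong (σ a) (λ u → ⟨⟩-extend-++ σ (λ v → f (u · v)) x y) ⟩
      ⟨ (λ u → ⟨ (λ v → ⟨ (λ w → f (u · (v · w))) ∣ extend σ y ⟩) ∣ extend σ x ⟩) ∣ σ a ⟩
        ≈⟨ ⟨⟩-cong (σ a) (λ u → ⟨⟩-cong (extend σ x) (λ v → ⟨⟩-cong (extend σ y) (λ w →
             reflexive (≡.cong f (≡.sym (·-assoc u v w)))))) ⟩
      ⟨ (λ u → ⟨ (λ v → ⟨ (λ w → f ((u · v) · w)) ∣ extend σ y ⟩) ∣ extend σ x ⟩) ∣ σ a ⟩
        ≈⟨ ⟨⟩-⊛ _ (σ a) (extend σ x) ⟨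
      ⟨ (λ u → ⟨ (λ w → f (u · w)) ∣ extend σ y ⟩) ∣ σ a ⊛ extend σ x ⟩ ∎

    ⟨⟩-extend-letter : ∀ {A : Set} (σ : A → LinComb B) (f : B → Carrier) a →
                       ⟨ f ∣ extend σ (a ∷ []) ⟩ ≈ ⟨ f ∣ σ a ⟩
    ⟨⟩-extend-letter σ f a = trans (⟨⟩-⊛ f (σ a) _) (⟨⟩-cong (σ a) (λ u →
      trans (⟨⟩-singleton (λ v → f (u · v)) ε) (reflexive (≡.cong f (proj₂ ·-identity u)))))

  module _ {A : Set} where

    infixr 5 _++₂_

    _++₂_ : List A × List A → List A × List A → List A × List A
    (u , u') ++₂ (v , v') = (u ++ v , u' ++ v')

    ++₂-assoc : Associative _≡_ _++₂_
    ++₂-assoc (u , u') (v , v') (w , w') = ≡.cong₂ _,_ (List.++-assoc u v w) (List.++-assoc u' v' w')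

    ++₂-identity : Identity _≡_ ([] , []) _++₂_
    ++₂-identity = (λ _ → ≡.refl) , λ (u , u') → ≡.cong₂ _,_ (List.++-identityʳ u) (List.++-identityʳ u')

  open module Words {A : Set} = MonoidAlgebra (_++_ {A = A}) [] List.++-assoc List.++-identity public
  open module WordPairs {A : Set} = MonoidAlgebra (_++₂_ {A = A}) ([] , []) ++₂-assoc ++₂-identity public
    renaming (_⊛_ to _⊛₂_; ⟨⟩-⊛ to ⟨⟩-⊛₂; extend to extend₂; ⟨⟩-extend-++ to ⟨⟩-extend₂-++;
              ⟨⟩-extend-letter to ⟨⟩-extend₂-letter)

module Intertwining {c ℓ} (K : CommutativeRing c ℓ) {A B : Set} (σ : A → LinearCombinations.LinComb K (List B))
                    (δA : A → LinearCombinations.LinComb K (List A × List A))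
                    (δB : B → LinearCombinations.LinComb K (List B × List B)) where

  open CommutativeRing K
  open FiniteSums K
  open LinearCombinations K
  open import Relation.Binary.Reasoning.Setoid setoid

  F : List A → LinComb (List B)
  F = extend σ

  ΔA : List A → LinComb (List A × List A)
  ΔA = extend₂ δA

  ΔB : List B → LinComb (List B × List B)
  ΔB = extend₂ δB

  F⊗Fᵀ : (List B × List B → Carrier) → List A × List A → Carrier
  F⊗Fᵀ h (x , x') = ⟨ (λ y → ⟨ (λ y' → h (y , y')) ∣ F x' ⟩) ∣ F x ⟩

  -- ΔB p = (F ⊗ F) q, tested against every functional h on the tensor square.
  Intertwines : LinComb (List B) → LinComb (List A × List A) → Set (c ⊔ ℓ)
  Intertwines p q = ∀ h → ⟨ (λ y → ⟨ h ∣ ΔB y ⟩) ∣ p ⟩ ≈ ⟨ F⊗Fᵀ h ∣ q ⟩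

  F⊗Fᵀ-++₂ : ∀ h x x' Z → F⊗Fᵀ h ((x , x') ++₂ Z) ≈
             ⟨ (λ y → ⟨ (λ y' → F⊗Fᵀ (λ Y → h ((y , y') ++₂ Y)) Z) ∣ F x' ⟩) ∣ F x ⟩
  F⊗Fᵀ-++₂ h x x' (z , z') = begin
    ⟨ (λ y → ⟨ (λ y' → h (y , y')) ∣ F (x' ++ z') ⟩) ∣ F (x ++ z) ⟩
      ≈⟨ ⟨⟩-extend-++ σ _ x z ⟩
    ⟨ (λ y → ⟨ (λ v → ⟨ (λ y' → h (y ++ v , y')) ∣ F (x' ++ z') ⟩) ∣ F z ⟩) ∣ F x ⟩
      ≈⟨ ⟨⟩-cong (F x) (λ y → ⟨⟩-cong (F z) (λ v → ⟨⟩-extend-++ σ _ x' z')) ⟩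
    ⟨ (λ y → ⟨ (λ v → ⟨ (λ y' → ⟨ (λ v' → h (y ++ v , y' ++ v')) ∣ F z' ⟩) ∣ F x' ⟩) ∣ F z ⟩) ∣ F x ⟩
      ≈⟨ ⟨⟩-cong (F x) (λ y → ⟨⟩-comm _ (F z) (F x')) ⟩
    ⟨ (λ y → ⟨ (λ y' → ⟨ (λ v → ⟨ (λ v' → h (y ++ v , y' ++ v')) ∣ F z' ⟩) ∣ F z ⟩) ∣ F x' ⟩) ∣ F x ⟩ ∎

  ⟨F⊗Fᵀ∣⟩-++₂ : ∀ h X q →
                F⊗Fᵀ (λ Y → ⟨ F⊗Fᵀ (λ Z → h (Y ++₂ Z)) ∣ q ⟩) X ≈ ⟨ (λ Y → F⊗Fᵀ h (X ++₂ Y)) ∣ q ⟩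
  ⟨F⊗Fᵀ∣⟩-++₂ h (x , x') q = begin
    ⟨ (λ y → ⟨ (λ y' → ⟨ F⊗Fᵀ (λ Z → h ((y , y') ++₂ Z)) ∣ q ⟩) ∣ F x' ⟩) ∣ F x ⟩
      ≈⟨ ⟨⟩-cong (F x) (λ y → ⟨⟩-comm _ (F x') q) ⟩
    ⟨ (λ y → ⟨ (λ Y → ⟨ (λ y' → F⊗Fᵀ (λ Z → h ((y , y') ++₂ Z)) Y) ∣ F x' ⟩) ∣ q ⟩) ∣ F x ⟩
      ≈⟨ ⟨⟩-comm _ (F x) q ⟩
    ⟨ (λ Y → ⟨ (λ y → ⟨ (λ y' → F⊗Fᵀ (λ Z → h ((y , y') ++₂ Z)) Y) ∣ F x' ⟩) ∣ F x ⟩) ∣ q ⟩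
      ≈⟨ ⟨⟩-cong q (λ Y → F⊗Fᵀ-++₂ h x x' Y) ⟨
    ⟨ (λ Y → F⊗Fᵀ h ((x , x') ++₂ Y)) ∣ q ⟩ ∎

  intertwines-extend : (∀ a → Intertwines (σ a) (δA a)) → ∀ w → Intertwines (F w) (ΔA w)
  intertwines-extend on-letters [] h = begin
    ⟨ (λ y → ⟨ h ∣ ΔB y ⟩) ∣ F [] ⟩     ≈⟨ ⟨⟩-singleton (λ y → ⟨ h ∣ ΔB y ⟩) [] ⟩
    ⟨ h ∣ ΔB [] ⟩                       ≈⟨ ⟨⟩-singleton h ([] , []) ⟩
    h ([] , [])                         ≈⟨ ⟨⟩-singleton (λ y' → h ([] , y')) [] ⟨
    ⟨ (λ y' → h ([] , y')) ∣ F [] ⟩     ≈⟨ ⟨⟩-singleton (λ y → ⟨ (λ y' → h (y , y')) ∣ F [] ⟩) [] ⟨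
    F⊗Fᵀ h ([] , [])                    ≈⟨ ⟨⟩-singleton (F⊗Fᵀ h) ([] , []) ⟨
    ⟨ F⊗Fᵀ h ∣ ΔA [] ⟩                  ∎
  intertwines-extend on-letters (a ∷ w) h = begin
    ⟨ (λ y → ⟨ h ∣ ΔB y ⟩) ∣ σ a ⊛ F w ⟩
      ≈⟨ ⟨⟩-⊛ _ (σ a) (F w) ⟩
    ⟨ (λ u → ⟨ (λ v → ⟨ h ∣ ΔB (u ++ v) ⟩) ∣ F w ⟩) ∣ σ a ⟩
      ≈⟨ ⟨⟩-cong (σ a) (λ u → ⟨⟩-cong (F w) (λ v → ⟨⟩-extend₂-++ δB h u v)) ⟩
    ⟨ (λ u → ⟨ (λ v → ⟨ (λ U → ⟨ (λ V → h (U ++₂ V)) ∣ ΔB v ⟩) ∣ ΔB u ⟩) ∣ F w ⟩) ∣ σ a ⟩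
      ≈⟨ ⟨⟩-cong (σ a) (λ u → ⟨⟩-comm _ (F w) (ΔB u)) ⟩
    ⟨ (λ u → ⟨ (λ U → ⟨ (λ v → ⟨ (λ V → h (U ++₂ V)) ∣ ΔB v ⟩) ∣ F w ⟩) ∣ ΔB u ⟩) ∣ σ a ⟩
      ≈⟨ ⟨⟩-cong (σ a) (λ u → ⟨⟩-cong (ΔB u) (λ U → intertwines-extend on-letters w (λ V → h (U ++₂ V)))) ⟩
    ⟨ (λ u → ⟨ (λ U → ⟨ F⊗Fᵀ (λ V → h (U ++₂ V)) ∣ ΔA w ⟩) ∣ ΔB u ⟩) ∣ σ a ⟩
      ≈⟨ on-letters a _ ⟩
    ⟨ F⊗Fᵀ (λ U → ⟨ F⊗Fᵀ (λ V → h (U ++₂ V)) ∣ ΔA w ⟩) ∣ δA a ⟩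
      ≈⟨ ⟨⟩-cong (δA a) (λ X → ⟨F⊗Fᵀ∣⟩-++₂ h X (ΔA w)) ⟩
    ⟨ (λ X → ⟨ (λ Y → F⊗Fᵀ h (X ++₂ Y)) ∣ ΔA w ⟩) ∣ δA a ⟩
      ≈⟨ ⟨⟩-⊛₂ (F⊗Fᵀ h) (δA a) (ΔA w) ⟨
    ⟨ F⊗Fᵀ h ∣ δA a ⊛₂ ΔA w ⟩ ∎

  F⊗Fᵀ-letter : ∀ h a a' → F⊗Fᵀ h (a ∷ [] , a' ∷ []) ≈ ⟨ (λ y → ⟨ (λ y' → h (y , y')) ∣ σ a' ⟩) ∣ σ a ⟩
  F⊗Fᵀ-letter h a a' =
    trans (⟨⟩-extend-letter σ _ a) (⟨⟩-cong (σ a) (λ y → ⟨⟩-extend-letter σ (λ y' → h (y , y')) a'))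

  F⊗Fᵀ-prim : ∀ h a → ⟨ F⊗Fᵀ h ∣ prim (a ∷ []) ⟩ ≈ ⟨ (λ y → ⟨ h ∣ prim y ⟩) ∣ σ a ⟩
  F⊗Fᵀ-prim h a = begin
    ⟨ F⊗Fᵀ h ∣ prim (a ∷ []) ⟩
      ≈⟨ ⟨⟩-prim (F⊗Fᵀ h) (a ∷ []) ⟩
    F⊗Fᵀ h (a ∷ [] , []) + F⊗Fᵀ h ([] , a ∷ [])
      ≈⟨ +-cong (trans (⟨⟩-extend-letter σ _ a) (⟨⟩-cong (σ a) (λ y → ⟨⟩-singleton (λ y' → h (y , y')) [])))
                (trans (⟨⟩-singleton (λ y → ⟨ (λ y' → h (y , y')) ∣ F (a ∷ []) ⟩) []) (⟨⟩-extend-letter σ _ a)) ⟩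
    ⟨ (λ y → h (y , [])) ∣ σ a ⟩ + ⟨ (λ y → h ([] , y)) ∣ σ a ⟩
      ≈⟨ ⟨⟩-distrib-+ (λ y → h (y , [])) (λ y → h ([] , y)) (σ a) ⟨
    ⟨ (λ y → h (y , []) + h ([] , y)) ∣ σ a ⟩
      ≈⟨ ⟨⟩-cong (σ a) (⟨⟩-prim h) ⟨
    ⟨ (λ y → ⟨ h ∣ prim y ⟩) ∣ σ a ⟩ ∎

  ΔB-letters : ∀ h {i} {I : Set i} (L : List I) coef letter →
               ⟨ (λ y → ⟨ h ∣ ΔB y ⟩) ∣ letters L coef letter ⟩ ≈ ∑[ i ∈ L ] (coef i * ⟨ h ∣ δB (letter i) ⟩)
  ΔB-letters h L coef letter = trans (reflexive (⟨⟩-letters _ L coef letter))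
                                     (∑-cong L (λ i → *-congˡ (⟨⟩-extend₂-letter δB h (letter i))))

  letters-prim : (∀ b → δB b ≡ prim (b ∷ [])) → ∀ {i} {I : Set i} (L : List I) coef letter h →
                 ⟨ (λ y → ⟨ h ∣ ΔB y ⟩) ∣ letters L coef letter ⟩ ≈
                 ⟨ (λ y → ⟨ h ∣ prim y ⟩) ∣ letters L coef letter ⟩
  letters-prim δB-prim L coef letter h = begin
    ⟨ (λ y → ⟨ h ∣ ΔB y ⟩) ∣ letters L coef letter ⟩      ≈⟨ ΔB-letters h L coef letter ⟩
    ∑[ i ∈ L ] (coef i * ⟨ h ∣ δB (letter i) ⟩)
      ≈⟨ ∑-cong L (λ i → *-congˡ (reflexive (≡.cong ⟨ h ∣_⟩ (δB-prim (letter i))))) ⟩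
    ∑[ i ∈ L ] (coef i * ⟨ h ∣ prim (letter i ∷ []) ⟩)     ≡⟨ ⟨⟩-letters _ L coef letter ⟨
    ⟨ (λ y → ⟨ h ∣ prim y ⟩) ∣ letters L coef letter ⟩    ∎

  prim-intertwines : ∀ a → (∀ h → ⟨ (λ y → ⟨ h ∣ ΔB y ⟩) ∣ σ a ⟩ ≈ ⟨ (λ y → ⟨ h ∣ prim y ⟩) ∣ σ a ⟩) →
                     Intertwines (σ a) (prim (a ∷ []))
  prim-intertwines a σa-prim h = trans (σa-prim h) (sym (F⊗Fᵀ-prim h a))

module Graded {c ℓ} (K : CommutativeRing c ℓ) where

  open CommutativeRing K
  open FiniteSums K
  open LinearCombinations K

  Homogeneous : {B : Set} → (B → ℕ) → ℕ → LinComb B → Set c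
  Homogeneous weight d p = All (λ t → weight (proj₂ t) ≡ d) p

  record GradedAlphabet (A : Set) : Set (c ⊔ ℓ) where
    field
      _≟_          : DecidableEquality A
      weight       : List A → ℕ
      weight-[]    : weight [] ≡ 0
      weight-++    : ∀ u v → weight (u ++ v) ≡ weight u ℕ.+ weight v
      words        : ℕ → List (List A)
      words-weight : ∀ d → All (λ w → weight w ≡ d) (words d)
      words-once   : ∀ {d} x → weight x ≡ d → OccursOnce (List.≡-dec _≟_) x (words d)

    _≟ʷ_ : DecidableEquality (List A)
    _≟ʷ_ = List.≡-dec _≟_

    sift-degree : ∀ d x (g : List A → Carrier) → (weight x ≢ d → g x ≈ 0#) →
                  ∑[ w ∈ words d ] (𝟙 (x ≟ʷ w) * g w) ≈ g x
    sift-degree d x g off with weight x ℕ.≟ d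
    ... | yes x∈d = trans (sifts (words-once x x∈d) g) (*-identityˡ (g x))
    ... | no  x∉d = trans (∑-zero-All (words-weight d) (λ {w} w∈d →
                            trans (*-congʳ (𝟙-no (x ≟ʷ w) (λ { ≡.refl → x∉d w∈d }))) (zeroˡ (g w))))
                          (sym (off x∉d))

    ⊛-homogeneous : ∀ {d e} {p q : LinComb (List A)} → Homogeneous weight d p → Homogeneous weight e q →
                    Homogeneous weight (d ℕ.+ e) (p ⊛ q)
    ⊛-homogeneous hp hq =
      concat⁺ (gmap⁺ (λ ps → gmap⁺ (λ qt → ≡.trans (weight-++ _ _) (≡.cong₂ ℕ._+_ ps qt)) hq) hp)

module SeriesTransfer {c ℓ} (K : CommutativeRing c ℓ) {A B : Set}
                      (GA : Graded.GradedAlphabet K A) (GB : Graded.GradedAlphabet K B)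
                      (σ : A → LinearCombinations.LinComb K (List B))
                      (δA : A → LinearCombinations.LinComb K (List A × List A))
                      (δB : B → LinearCombinations.LinComb K (List B × List B)) where

  open CommutativeRing K
  open FiniteSums K
  open LinearCombinations K
  open Graded K
  open Intertwining K σ δA δB
  open import Relation.Binary.Reasoning.Setoid setoid
  private
    module GA = GradedAlphabet GA
    module GB = GradedAlphabet GB

  -- The series maps of Defs, for arbitrary graded alphabets; the instances below are
  -- definitionally 𝓕, Δш, 𝓕⊗𝓕 and 𝓕Y, Δ*, 𝓕Y⊗𝓕Y.
  𝓕ˢ : (List A → Carrier) → List B → Carrier
  𝓕ˢ S v = ∑[ w ∈ GA.words (GB.weight v) ] (S w * coefficient GB._≟_ v (F w))

  coproductˢ : {C : Set} → GradedAlphabet C → (C → LinComb (List C × List C)) →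
               (List C → Carrier) → List C → List C → Carrier
  coproductˢ G δ S u v = ∑[ w ∈ words (weight u ℕ.+ weight v) ] (S w * coefficient₂ _≟_ u v (extend₂ δ w))
    where open GradedAlphabet G

  coefficient-F⊗F : List B → List B → List A → List A → Carrier
  coefficient-F⊗F u v x x' = coefficient GB._≟_ u (F x) * coefficient GB._≟_ v (F x')

  𝓕⊗𝓕ˢ : (List A → List A → Carrier) → List B → List B → Carrier
  𝓕⊗𝓕ˢ T u v = ∑[ w ∈ GA.words (GB.weight u) ] ∑[ w' ∈ GA.words (GB.weight v) ] (T w w' * coefficient-F⊗F u v w w')

  module _ (σ-homogeneous : ∀ a → Homogeneous GB.weight (GA.weight (a ∷ [])) (σ a)) where

    F-homogeneous : ∀ w → Homogeneous GB.weight (GA.weight w) (F w)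
    F-homogeneous []      = ≡.trans GB.weight-[] (≡.sym GA.weight-[]) ∷ []
    F-homogeneous (a ∷ w) = ≡.subst (λ d → Homogeneous GB.weight d (σ a ⊛ F w)) (≡.sym (GA.weight-++ (a ∷ []) w))
                                    (GB.⊛-homogeneous (σ-homogeneous a) (F-homogeneous w))

    ∑-coefficient-F : ∀ {d} w̃ (g : List B → Carrier) → GA.weight w̃ ≡ d →
                      ∑[ w ∈ GB.words d ] (coefficient GB._≟_ w (F w̃) * g w) ≈ ⟨ g ∣ F w̃ ⟩
    ∑-coefficient-F {d} w̃ g w̃∈d = begin
      ∑[ w ∈ GB.words d ] (coefficient GB._≟_ w (F w̃) * g w)
        ≈⟨ ∑-cong (GB.words d) (λ w →
             trans (*-congʳ (coefficient-pairing GB._≟_ w (F w̃))) (sym (⟨⟩-*ʳ (g w) _ (F w̃)))) ⟩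
      ∑[ w ∈ GB.words d ] ⟨ (λ x → 𝟙 (x GB.≟ʷ w) * g w) ∣ F w̃ ⟩
        ≈⟨ ∑-⟨⟩-comm _ (GB.words d) (F w̃) ⟩
      ⟨ (λ x → ∑[ w ∈ GB.words d ] (𝟙 (x GB.≟ʷ w) * g w)) ∣ F w̃ ⟩
        ≈⟨ ⟨⟩-cong-All (F-homogeneous w̃) (λ x∈w̃ →
             trans (sifts (GB.words-once _ (≡.trans x∈w̃ w̃∈d)) g) (*-identityˡ _)) ⟩
      ⟨ g ∣ F w̃ ⟩ ∎

    coefficient-F-off-degree : ∀ u x → GA.weight x ≢ GB.weight u → coefficient GB._≟_ u (F x) ≈ 0#
    coefficient-F-off-degree u x off = begin
      coefficient GB._≟_ u (F x)               ≈⟨ coefficient-pairing GB._≟_ u (F x) ⟩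
      ⟨ (λ y → 𝟙 (y GB.≟ʷ u)) ∣ F x ⟩
        ≈⟨ ⟨⟩-cong-All (F-homogeneous x) (λ {y} y∈x → 𝟙-no (y GB.≟ʷ u) (λ { ≡.refl → off (≡.sym y∈x) })) ⟩
      ⟨ (λ _ → 0#) ∣ F x ⟩                     ≈⟨ ⟨⟩-zero (F x) (λ _ → refl) ⟩
      0#                                        ∎

    sift-F⊗F : ∀ u v X →
      ∑[ w ∈ GA.words (GB.weight u) ] ∑[ w' ∈ GA.words (GB.weight v) ] (δ₂ GA._≟_ w w' X * coefficient-F⊗F u v w w')
        ≈ coefficient-F⊗F u v (proj₁ X) (proj₂ X)
    sift-F⊗F u v (x , x') = begin
      ∑[ w ∈ GA.words (GB.weight u) ] ∑[ w' ∈ GA.words (GB.weight v) ]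
        ((𝟙 (x GA.≟ʷ w) * 𝟙 (x' GA.≟ʷ w')) * coefficient-F⊗F u v w w')
        ≈⟨ ∑-cong (GA.words (GB.weight u)) (λ w → trans (∑-cong (GA.words (GB.weight v)) (λ w' → *-assoc _ _ _))
             (sym (*-distribˡ-∑ _ (λ w' → 𝟙 (x' GA.≟ʷ w') * coefficient-F⊗F u v w w') (GA.words (GB.weight v))))) ⟩
      ∑[ w ∈ GA.words (GB.weight u) ] (𝟙 (x GA.≟ʷ w) *
        ∑[ w' ∈ GA.words (GB.weight v) ] (𝟙 (x' GA.≟ʷ w') * coefficient-F⊗F u v w w'))
        ≈⟨ ∑-cong (GA.words (GB.weight u)) (λ w → *-congˡ (GA.sift-degree _ x' (coefficient-F⊗F u v w)
             (λ off → trans (*-congˡ (coefficient-F-off-degree v x' off)) (zeroʳ _)))) ⟩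
      ∑[ w ∈ GA.words (GB.weight u) ] (𝟙 (x GA.≟ʷ w) * coefficient-F⊗F u v w x')
        ≈⟨ GA.sift-degree _ x (λ w → coefficient-F⊗F u v w x')
             (λ off → trans (*-congʳ (coefficient-F-off-degree u x off)) (zeroˡ _)) ⟩
      coefficient-F⊗F u v x x' ∎

    F⊗Fᵀ-δ₂ : ∀ u v X → F⊗Fᵀ (δ₂ GB._≟_ u v) X ≈ coefficient-F⊗F u v (proj₁ X) (proj₂ X)
    F⊗Fᵀ-δ₂ u v (x , x') = begin
      ⟨ (λ y → ⟨ (λ y' → 𝟙 (y GB.≟ʷ u) * 𝟙 (y' GB.≟ʷ v)) ∣ F x' ⟩) ∣ F x ⟩
        ≈⟨ ⟨⟩-cong (F x) (λ y → ⟨⟩-*ˡ (𝟙 (y GB.≟ʷ u)) (λ y' → 𝟙 (y' GB.≟ʷ v)) (F x')) ⟩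
      ⟨ (λ y → 𝟙 (y GB.≟ʷ u) * ⟨ (λ y' → 𝟙 (y' GB.≟ʷ v)) ∣ F x' ⟩) ∣ F x ⟩
        ≈⟨ ⟨⟩-*ʳ _ (λ y → 𝟙 (y GB.≟ʷ u)) (F x) ⟩
      ⟨ (λ y → 𝟙 (y GB.≟ʷ u)) ∣ F x ⟩ * ⟨ (λ y' → 𝟙 (y' GB.≟ʷ v)) ∣ F x' ⟩
        ≈⟨ *-cong (coefficient-pairing GB._≟_ u (F x)) (coefficient-pairing GB._≟_ v (F x')) ⟨
      coefficient-F⊗F u v x x' ∎

    ∑-coefficient₂-F⊗F : ∀ u v Q →
      ∑[ w ∈ GA.words (GB.weight u) ] ∑[ w' ∈ GA.words (GB.weight v) ]
        (coefficient₂ GA._≟_ w w' Q * coefficient-F⊗F u v w w') ≈ ⟨ F⊗Fᵀ (δ₂ GB._≟_ u v) ∣ Q ⟩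
    ∑-coefficient₂-F⊗F u v Q = begin
      ∑[ w ∈ GA.words (GB.weight u) ] ∑[ w' ∈ GA.words (GB.weight v) ]
        (coefficient₂ GA._≟_ w w' Q * coefficient-F⊗F u v w w')
        ≈⟨ ∑-cong (GA.words (GB.weight u)) (λ w → ∑-cong (GA.words (GB.weight v)) (λ w' →
             trans (*-congʳ (coefficient₂-pairing GA._≟_ w w' Q)) (sym (⟨⟩-*ʳ _ (δ₂ GA._≟_ w w') Q)))) ⟩
      ∑[ w ∈ GA.words (GB.weight u) ] ∑[ w' ∈ GA.words (GB.weight v) ]
        ⟨ (λ X → δ₂ GA._≟_ w w' X * coefficient-F⊗F u v w w') ∣ Q ⟩
        ≈⟨ ∑-cong (GA.words (GB.weight u)) (λ w →
             ∑-⟨⟩-comm (λ w' X → δ₂ GA._≟_ w w' X * coefficient-F⊗F u v w w') (GA.words (GB.weight v)) Q) ⟩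
      ∑[ w ∈ GA.words (GB.weight u) ]
        ⟨ (λ X → ∑[ w' ∈ GA.words (GB.weight v) ] (δ₂ GA._≟_ w w' X * coefficient-F⊗F u v w w')) ∣ Q ⟩
        ≈⟨ ∑-⟨⟩-comm (λ w X → ∑[ w' ∈ GA.words (GB.weight v) ] (δ₂ GA._≟_ w w' X * coefficient-F⊗F u v w w'))
             (GA.words (GB.weight u)) Q ⟩
      ⟨ (λ X → ∑[ w ∈ GA.words (GB.weight u) ] ∑[ w' ∈ GA.words (GB.weight v) ]
        (δ₂ GA._≟_ w w' X * coefficient-F⊗F u v w w')) ∣ Q ⟩
        ≈⟨ ⟨⟩-cong Q (λ X → trans (sift-F⊗F u v X) (sym (F⊗Fᵀ-δ₂ u v X))) ⟩
      ⟨ F⊗Fᵀ (δ₂ GB._≟_ u v) ∣ Q ⟩ ∎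

    coproductˢ-𝓕ˢ : ∀ S u v → coproductˢ GB δB (𝓕ˢ S) u v ≈
      ∑[ w̃ ∈ GA.words (GB.weight u ℕ.+ GB.weight v) ] (S w̃ * ⟨ (λ y → ⟨ δ₂ GB._≟_ u v ∣ ΔB y ⟩) ∣ F w̃ ⟩)
    coproductˢ-𝓕ˢ S u v = begin
      ∑[ w ∈ GB.words d ] (𝓕ˢ S w * c₂ w)
        ≈⟨ ∑-cong-All (GB.words-weight d) (λ {w} w∈d → trans
             (*-congʳ (reflexive (≡.cong (λ e → ∑[ w̃ ∈ GA.words e ] (S w̃ * coefficient GB._≟_ w (F w̃))) w∈d)))
             (*-distribʳ-∑ (c₂ w) (λ w̃ → S w̃ * coefficient GB._≟_ w (F w̃)) (GA.words d))) ⟩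
      ∑[ w ∈ GB.words d ] ∑[ w̃ ∈ GA.words d ] ((S w̃ * coefficient GB._≟_ w (F w̃)) * c₂ w)
        ≈⟨ ∑-comm (λ w w̃ → (S w̃ * coefficient GB._≟_ w (F w̃)) * c₂ w) (GB.words d) (GA.words d) ⟩
      ∑[ w̃ ∈ GA.words d ] ∑[ w ∈ GB.words d ] ((S w̃ * coefficient GB._≟_ w (F w̃)) * c₂ w)
        ≈⟨ ∑-cong-All (GA.words-weight d) (λ {w̃} w̃∈d → trans
             (∑-cong (GB.words d) (λ w → *-assoc _ _ _))
             (trans (sym (*-distribˡ-∑ (S w̃) (λ w → coefficient GB._≟_ w (F w̃) * c₂ w) (GB.words d)))
                    (*-congˡ (∑-coefficient-F w̃ c₂ w̃∈d)))) ⟩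
      ∑[ w̃ ∈ GA.words d ] (S w̃ * ⟨ c₂ ∣ F w̃ ⟩)
        ≈⟨ ∑-cong (GA.words d) (λ w̃ → *-congˡ (⟨⟩-cong (F w̃) (λ y → coefficient₂-pairing GB._≟_ u v (ΔB y)))) ⟩
      ∑[ w̃ ∈ GA.words d ] (S w̃ * ⟨ (λ y → ⟨ δ₂ GB._≟_ u v ∣ ΔB y ⟩) ∣ F w̃ ⟩) ∎
      where
      d = GB.weight u ℕ.+ GB.weight v
      c₂ : List B → Carrier
      c₂ w = coefficient₂ GB._≟_ u v (ΔB w)

    𝓕⊗𝓕ˢ-coproductˢ : ∀ S u v → 𝓕⊗𝓕ˢ (coproductˢ GA δA S) u v ≈
      ∑[ w̃ ∈ GA.words (GB.weight u ℕ.+ GB.weight v) ] (S w̃ * ⟨ F⊗Fᵀ (δ₂ GB._≟_ u v) ∣ ΔA w̃ ⟩)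
    𝓕⊗𝓕ˢ-coproductˢ S u v = begin
      ∑[ w ∈ Wu ] ∑[ w' ∈ Wv ] (coproductˢ GA δA S w w' * coefficient-F⊗F u v w w')
        ≈⟨ ∑-cong-All (GA.words-weight _) (λ {w} w∈u → ∑-cong-All (GA.words-weight _) (λ {w'} w'∈v → trans
             (*-congʳ (reflexive (≡.cong (λ e → ∑[ w̃ ∈ GA.words e ] (S w̃ * c₂ w w' w̃)) (≡.cong₂ ℕ._+_ w∈u w'∈v))))
             (trans (*-distribʳ-∑ _ (λ w̃ → S w̃ * c₂ w w' w̃) (GA.words d))
                    (∑-cong (GA.words d) (λ w̃ → *-assoc _ _ _))))) ⟩
      ∑[ w ∈ Wu ] ∑[ w' ∈ Wv ] ∑[ w̃ ∈ GA.words d ] (S w̃ * (c₂ w w' w̃ * coefficient-F⊗F u v w w'))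
        ≈⟨ ∑-cong Wu (λ w → ∑-comm (λ w' w̃ → S w̃ * (c₂ w w' w̃ * coefficient-F⊗F u v w w')) Wv (GA.words d)) ⟩
      ∑[ w ∈ Wu ] ∑[ w̃ ∈ GA.words d ] ∑[ w' ∈ Wv ] (S w̃ * (c₂ w w' w̃ * coefficient-F⊗F u v w w'))
        ≈⟨ ∑-comm (λ w w̃ → ∑[ w' ∈ Wv ] (S w̃ * (c₂ w w' w̃ * coefficient-F⊗F u v w w'))) Wu (GA.words d) ⟩
      ∑[ w̃ ∈ GA.words d ] ∑[ w ∈ Wu ] ∑[ w' ∈ Wv ] (S w̃ * (c₂ w w' w̃ * coefficient-F⊗F u v w w'))
        ≈⟨ ∑-cong (GA.words d) (λ w̃ → trans
             (∑-cong Wu (λ w → sym (*-distribˡ-∑ (S w̃) (λ w' → c₂ w w' w̃ * coefficient-F⊗F u v w w') Wv)))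
             (sym (*-distribˡ-∑ (S w̃) (λ w → ∑[ w' ∈ Wv ] (c₂ w w' w̃ * coefficient-F⊗F u v w w')) Wu))) ⟩
      ∑[ w̃ ∈ GA.words d ] (S w̃ * ∑[ w ∈ Wu ] ∑[ w' ∈ Wv ] (c₂ w w' w̃ * coefficient-F⊗F u v w w'))
        ≈⟨ ∑-cong (GA.words d) (λ w̃ → *-congˡ (∑-coefficient₂-F⊗F u v (ΔA w̃))) ⟩
      ∑[ w̃ ∈ GA.words d ] (S w̃ * ⟨ F⊗Fᵀ (δ₂ GB._≟_ u v) ∣ ΔA w̃ ⟩) ∎
      where
      d  = GB.weight u ℕ.+ GB.weight v
      Wu = GA.words (GB.weight u)
      Wv = GA.words (GB.weight v)
      c₂ : List A → List A → List A → Carrier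
      c₂ w w' w̃ = coefficient₂ GA._≟_ w w' (ΔA w̃)

    𝓕ˢ-preserves-coproduct : (∀ a → Intertwines (σ a) (δA a)) →
      ∀ S u v → coproductˢ GB δB (𝓕ˢ S) u v ≈ 𝓕⊗𝓕ˢ (coproductˢ GA δA S) u v
    𝓕ˢ-preserves-coproduct σ-intertwines S u v = begin
      coproductˢ GB δB (𝓕ˢ S) u v
        ≈⟨ coproductˢ-𝓕ˢ S u v ⟩
      ∑[ w̃ ∈ GA.words d ] (S w̃ * ⟨ (λ y → ⟨ δ₂ GB._≟_ u v ∣ ΔB y ⟩) ∣ F w̃ ⟩)
        ≈⟨ ∑-cong (GA.words d) (λ w̃ → *-congˡ (intertwines-extend σ-intertwines w̃ (δ₂ GB._≟_ u v))) ⟩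
      ∑[ w̃ ∈ GA.words d ] (S w̃ * ⟨ F⊗Fᵀ (δ₂ GB._≟_ u v) ∣ ΔA w̃ ⟩)
        ≈⟨ 𝓕⊗𝓕ˢ-coproductˢ S u v ⟨
      𝓕⊗𝓕ˢ (coproductˢ GA δA S) u v ∎
      where d = GB.weight u ℕ.+ GB.weight v

applyUpTo-tabulate : ∀ {A : Set} (f : ℕ → A) k → applyUpTo f k ≡ tabulate {n = k} (λ i → f (Fin.toℕ i))
applyUpTo-tabulate f zero    = ≡.refl
applyUpTo-tabulate f (suc k) = ≡.cong (f 0 ∷_) (applyUpTo-tabulate (λ m → f (suc m)) k)

module _ {M : ℕ} where

  private
    N = suc M

  toℕ-mod : ∀ (i : Fin N) → Fin.toℕ i mod N ≡ i
  toℕ-mod i = FinP.toℕ-injective (≡.trans (FinP.toℕ-fromℕ< _) (DM.m<n⇒m%n≡m (FinP.toℕ<n i)))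

  residues-1…N : map (_mod N) (map suc (upTo N)) ↭ allFin N
  residues-1…N = begin
    map (_mod N) (map suc (upTo N))
      ≡⟨ ≡.trans (≡.cong (map (_mod N)) (List.map-upTo suc N)) (List.map-applyUpTo suc (_mod N) N) ⟩
    applyUpTo (λ m → suc m mod N) N               ≡⟨ List.applyUpTo-∷ʳ (λ m → suc m mod N) M ⟨
    applyUpTo (λ m → suc m mod N) M ∷ʳ N mod N    ↭⟨ ↭.∷↭∷ʳ (N mod N) _ ⟨
    N mod N ∷ applyUpTo (λ m → suc m mod N) M     ≡⟨ ≡.cong (_∷ applyUpTo (λ m → suc m mod N) M) N-mod-N ⟩
    applyUpTo (_mod N) N                          ≡⟨ applyUpTo-tabulate (_mod N) N ⟩
    tabulate (λ i → Fin.toℕ i mod N)              ≡⟨ List.tabulate-cong toℕ-mod ⟩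
    allFin N                                      ∎
    where
    open PermutationReasoning
    N-mod-N : N mod N ≡ Fin.zero
    N-mod-N = FinP.toℕ-injective (≡.trans (FinP.toℕ-fromℕ< _) (DM.n%n≡0 N))

module Powers {c ℓ} (K : CommutativeRing c ℓ) where

  open CommutativeRing K
  open import Algebra.Properties.Semiring.Exp semiring public using (_^_; ^-homo-*; ^-assocʳ)
  open import Algebra.Properties.Semiring.Exp semiring using (^-congˡ)
  open import Relation.Binary.Reasoning.Setoid setoid

  1^q≈1 : ∀ q → 1# ^ q ≈ 1#
  1^q≈1 zero    = refl
  1^q≈1 (suc q) = trans (*-identityˡ _) (1^q≈1 q)

  ^-periodic : ∀ x d → x ^ d ≈ 1# → ∀ q → x ^ (q ℕ.* d) ≈ 1#
  ^-periodic x d x^d≈1 q = begin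
    x ^ (q ℕ.* d)   ≡⟨ ≡.cong (x ^_) (ℕP.*-comm q d) ⟩
    x ^ (d ℕ.* q)   ≈⟨ ^-assocʳ x d q ⟨
    (x ^ d) ^ q     ≈⟨ ^-congˡ q x^d≈1 ⟩
    1# ^ q          ≈⟨ 1^q≈1 q ⟩
    1#              ∎

  ^-% : ∀ x d .{{_ : ℕ.NonZero d}} → x ^ d ≈ 1# → ∀ m → x ^ (m ℕ.% d) ≈ x ^ m
  ^-% x d x^d≈1 m = sym (begin
    x ^ m                                      ≡⟨ ≡.cong (x ^_) (DM.m≡m%n+[m/n]*n m d) ⟩
    x ^ (m ℕ.% d ℕ.+ (m ℕ./ d) ℕ.* d)          ≈⟨ ^-homo-* x (m ℕ.% d) ((m ℕ./ d) ℕ.* d) ⟩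
    x ^ (m ℕ.% d) * x ^ ((m ℕ./ d) ℕ.* d)      ≈⟨ *-congˡ (^-periodic x d x^d≈1 (m ℕ./ d)) ⟩
    x ^ (m ℕ.% d) * 1#                         ≈⟨ *-identityʳ _ ⟩
    x ^ (m ℕ.% d)                              ∎)

module FourierTransform {c ℓ} (K : CommutativeRing c ℓ) (n : ℕ) (ζ : CommutativeRing.Carrier K) where

  open CommutativeRing K hiding (zero)
  open Hopf K n ζ
  open FiniteSums K
  open LinearCombinations K
  open Graded K
  open Powers K
  open import Algebra.Properties.CommutativeSemigroup *-commutativeSemigroup using (x∙yz≈y∙xz)
  open import Relation.Binary.Reasoning.Setoid setoid

  -- χ (ι⁻¹ α) m = ζ^{-m ι⁻¹(α)} is the coefficient of x_{ζ^m} in 𝓕(x̃_α).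
  χ : ℕ → ℕ → Carrier
  χ a m = pow ζ⁻¹ (m ℕ.* a)

  wordsLen-length : ∀ {A : Set} (L : List A) d → All (λ w → length w ≡ d) (wordsLen L d)
  wordsLen-length L zero    = ≡.refl ∷ []
  wordsLen-length L (suc d) = concat⁺ (map⁺ (All.universal (λ a → map⁺ (All.map (≡.cong suc) (wordsLen-length L d))) L))

  wordsLen-once : ∀ {A : Set} (_≟_ : DecidableEquality A) L → (∀ a → OccursOnce _≟_ a L) →
                  ∀ {d} x → length x ≡ d → OccursOnce (List.≡-dec _≟_) x (wordsLen L d)
  wordsLen-once _≟_ L once []      ≡.refl =
    multiplicity-cong _ (+-identityʳ 1#) (multiplicity-∷ _ [] [] (multiplicity-absent _ []))
  wordsLen-once _≟_ L once (a ∷ t) ≡.refl = multiplicity-cong _ (*-identityˡ 1#)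
    (multiplicity-prefixEach _≟_ (once a) (wordsLen-once _≟_ L once t ≡.refl))

  byLength : ∀ {A : Set} (_≟_ : DecidableEquality A) L → (∀ a → OccursOnce _≟_ a L) → GradedAlphabet A
  byLength _≟_ L once = record
    { _≟_          = _≟_
    ; weight       = length
    ; weight-[]    = ≡.refl
    ; weight-++    = λ u v → List.length-++ u
    ; words        = wordsLen L
    ; words-weight = wordsLen-length L
    ; words-once   = wordsLen-once _≟_ L once
    }

  allX-once : ∀ a → OccursOnce _≟X_ a allX
  allX-once x₀     = multiplicity-cong _≟X_ (+-identityʳ 1#) (multiplicity-∷ _≟X_ x₀ (map xζ (allFin N))
                       (multiplicity-absent _≟X_ (map⁺ (All.universal (λ _ ()) (allFin N)))))
  allX-once (xζ i) = multiplicity-cong _≟X_ (+-identityˡ 1#) (multiplicity-∷ _≟X_ x₀ (map xζ (allFin N))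
                       (multiplicity-map Fin._≟_ _≟X_ (λ { ≡.refl → ≡.refl }) (allFin N) (allFin-once N i)))

  allX̃-once : ∀ a → OccursOnce _≟X̃_ a allX̃
  allX̃-once x̃      = multiplicity-cong _≟X̃_ (+-identityʳ 1#) (multiplicity-∷ _≟X̃_ x̃ (map x̃α (allFin N))
                       (multiplicity-absent _≟X̃_ (map⁺ (All.universal (λ _ ()) (allFin N)))))
  allX̃-once (x̃α α) = multiplicity-cong _≟X̃_ (+-identityˡ 1#) (multiplicity-∷ _≟X̃_ x̃ (map x̃α (allFin N))
                       (multiplicity-map Fin._≟_ _≟X̃_ (λ { ≡.refl → ≡.refl }) (allFin N) (allFin-once N α)))

  module Shuffle where
    open Intertwining K σF σSh σSh
    open SeriesTransfer K (byLength _≟X̃_ allX̃ allX̃-once) (byLength _≟X_ allX allX-once) σF σSh σSh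

    σF-homogeneous : ∀ a → Homogeneous length (length (a ∷ [])) (σF a)
    σF-homogeneous x̃      = ≡.refl ∷ []
    σF-homogeneous (x̃α α) = map⁺ (All.universal (λ _ → ≡.refl) oneToN)

    σF-intertwines : ∀ a → Intertwines (σF a) (σSh a)
    σF-intertwines x̃      = prim-intertwines x̃ (letters-prim (λ _ → ≡.refl) (x₀ ∷ []) (λ _ → 1#) id)
    σF-intertwines (x̃α α) =
      prim-intertwines (x̃α α) (letters-prim (λ _ → ≡.refl) oneToN (χ (ιinv α)) (λ m → xζ (res m)))

    shuffle-compatible : (S : Series LX̃) (u v : List LX) → Δш (𝓕 S) u v ≈ 𝓕⊗𝓕 (Δш̃ S) u v
    shuffle-compatible = 𝓕ˢ-preserves-coproduct σF-homogeneous σF-intertwines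

  _⊕_ : Fin N → Fin N → Fin N
  i ⊕ j = res (Fin.toℕ i ℕ.+ Fin.toℕ j)

  ∑-oneToN : ∀ (Ψ : Fin N → Carrier) → ∑[ m ∈ oneToN ] Ψ (res m) ≈ ∑[ r ∈ allFin N ] Ψ r
  ∑-oneToN Ψ = trans (reflexive (≡.sym (∑-map Ψ res oneToN))) (∑-↭ Ψ residues-1…N)

  ∑-rootPairs : ∀ r (G : Fin N × Fin N → Carrier) →
    ∑ (rootPairs r) G ≈ ∑[ i ∈ allFin N ] ∑[ j ∈ allFin N ] (𝟙 ((i ⊕ j) Fin.≟ r) * G (i , j))
  ∑-rootPairs r G = trans (∑-concatMap G (λ i → concatMap (pairIf i) (allFin N)) (allFin N)) (∑-cong (allFin N) λ i →
    trans (∑-concatMap G (pairIf i) (allFin N)) (∑-cong (allFin N) λ j → ∑-if ((i ⊕ j) Fin.≟ r) (i , j)))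
    where
    pairIf : Fin N → Fin N → List (Fin N × Fin N)
    pairIf i j = if does ((i ⊕ j) Fin.≟ r) then (i , j) ∷ [] else []

    ∑-if : ∀ {p} {P : Set p} (P? : Dec P) x → ∑ (if does P? then x ∷ [] else []) G ≈ 𝟙 P? * G x
    ∑-if P? x with does P?
    ... | true  = trans (+-identityʳ _) (sym (*-identityˡ _))
    ... | false = sym (zeroˡ _)

  ∑-∑-rootPairs : ∀ (Φ : Fin N → Carrier) (G : Fin N × Fin N → Carrier) →
    ∑[ r ∈ allFin N ] (Φ r * ∑ (rootPairs r) G) ≈ ∑[ i ∈ allFin N ] ∑[ j ∈ allFin N ] (Φ (i ⊕ j) * G (i , j))
  ∑-∑-rootPairs Φ G = begin
    ∑[ r ∈ Fs ] (Φ r * ∑ (rootPairs r) G)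
      ≈⟨ ∑-cong Fs (λ r → trans (*-congˡ (∑-rootPairs r G)) (*-distribˡ-∑ (Φ r) _ Fs)) ⟩
    ∑[ r ∈ Fs ] ∑[ i ∈ Fs ] (Φ r * ∑[ j ∈ Fs ] (𝟙 ((i ⊕ j) Fin.≟ r) * G (i , j)))
      ≈⟨ ∑-cong Fs (λ r → ∑-cong Fs (λ i → trans (*-distribˡ-∑ (Φ r) (λ j → 𝟙 ((i ⊕ j) Fin.≟ r) * G (i , j)) Fs)
                                                 (∑-cong Fs (λ j → x∙yz≈y∙xz _ _ _)))) ⟩
    ∑[ r ∈ Fs ] ∑[ i ∈ Fs ] ∑[ j ∈ Fs ] (𝟙 ((i ⊕ j) Fin.≟ r) * (Φ r * G (i , j)))
      ≈⟨ ∑-comm (λ r i → ∑[ j ∈ Fs ] (𝟙 ((i ⊕ j) Fin.≟ r) * (Φ r * G (i , j)))) Fs Fs ⟩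
    ∑[ i ∈ Fs ] ∑[ r ∈ Fs ] ∑[ j ∈ Fs ] (𝟙 ((i ⊕ j) Fin.≟ r) * (Φ r * G (i , j)))
      ≈⟨ ∑-cong Fs (λ i → ∑-comm (λ r j → 𝟙 ((i ⊕ j) Fin.≟ r) * (Φ r * G (i , j))) Fs Fs) ⟩
    ∑[ i ∈ Fs ] ∑[ j ∈ Fs ] ∑[ r ∈ Fs ] (𝟙 ((i ⊕ j) Fin.≟ r) * (Φ r * G (i , j)))
      ≈⟨ ∑-cong Fs (λ i → ∑-cong Fs (λ j →
           trans (sifts (allFin-once N (i ⊕ j)) (λ r → Φ r * G (i , j))) (*-identityˡ _))) ⟩
    ∑[ i ∈ Fs ] ∑[ j ∈ Fs ] (Φ (i ⊕ j) * G (i , j)) ∎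
    where
    Fs = allFin N

  module Characters (ζ^N≈1 : pow ζ N ≈ 1#) where

    pow≡^ : ∀ x k → pow x k ≡ x ^ k
    pow≡^ x zero    = ≡.refl
    pow≡^ x (suc k) = ≡.cong (x *_) (pow≡^ x k)

    ζ⁻¹^a^N≈1 : ∀ a → (ζ⁻¹ ^ a) ^ N ≈ 1#
    ζ⁻¹^a^N≈1 a = trans (^-assocʳ ζ⁻¹ a N) (^-periodic ζ⁻¹ N ζ⁻¹^N≈1 a)
      where
      ζ⁻¹^N≈1 : ζ⁻¹ ^ N ≈ 1#
      ζ⁻¹^N≈1 = begin
        ζ⁻¹ ^ N                  ≡⟨ ≡.cong (_^ N) (pow≡^ ζ (N ∸ 1)) ⟩
        (ζ ^ (N ∸ 1)) ^ N        ≈⟨ ^-assocʳ ζ (N ∸ 1) N ⟩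
        ζ ^ ((N ∸ 1) ℕ.* N)      ≈⟨ ^-periodic ζ N (trans (reflexive (≡.sym (pow≡^ ζ N))) ζ^N≈1) (N ∸ 1) ⟩
        1#                       ∎

    χ≈^ : ∀ a m → χ a m ≈ (ζ⁻¹ ^ a) ^ m
    χ≈^ a m = begin
      pow ζ⁻¹ (m ℕ.* a)   ≡⟨ ≡.trans (pow≡^ ζ⁻¹ (m ℕ.* a)) (≡.cong (ζ⁻¹ ^_) (ℕP.*-comm m a)) ⟩
      ζ⁻¹ ^ (a ℕ.* m)     ≈⟨ ^-assocʳ ζ⁻¹ a m ⟨
      (ζ⁻¹ ^ a) ^ m       ∎

    χ-res : ∀ a m → χ a (Fin.toℕ (res m)) ≈ χ a m
    χ-res a m = begin
      χ a (Fin.toℕ (res m))          ≈⟨ χ≈^ a (Fin.toℕ (res m)) ⟩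
      (ζ⁻¹ ^ a) ^ Fin.toℕ (res m)    ≡⟨ ≡.cong ((ζ⁻¹ ^ a) ^_) (FinP.toℕ-fromℕ< (DM.m%n<n m N)) ⟩
      (ζ⁻¹ ^ a) ^ (m ℕ.% N)          ≈⟨ ^-% (ζ⁻¹ ^ a) N (ζ⁻¹^a^N≈1 a) m ⟩
      (ζ⁻¹ ^ a) ^ m                  ≈⟨ χ≈^ a m ⟨
      χ a m                          ∎

    χ-⊕ : ∀ a i j → χ a (Fin.toℕ (i ⊕ j)) ≈ χ a (Fin.toℕ i) * χ a (Fin.toℕ j)
    χ-⊕ a i j = begin
      χ a (Fin.toℕ (i ⊕ j))                      ≈⟨ χ-res a (Fin.toℕ i ℕ.+ Fin.toℕ j) ⟩
      χ a (Fin.toℕ i ℕ.+ Fin.toℕ j)              ≈⟨ χ≈^ a (Fin.toℕ i ℕ.+ Fin.toℕ j) ⟩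
      (ζ⁻¹ ^ a) ^ (Fin.toℕ i ℕ.+ Fin.toℕ j)      ≈⟨ ^-homo-* (ζ⁻¹ ^ a) (Fin.toℕ i) (Fin.toℕ j) ⟩
      (ζ⁻¹ ^ a) ^ Fin.toℕ i * (ζ⁻¹ ^ a) ^ Fin.toℕ j ≈⟨ *-cong (χ≈^ a (Fin.toℕ i)) (χ≈^ a (Fin.toℕ j)) ⟨
      χ a (Fin.toℕ i) * χ a (Fin.toℕ j)          ∎

    ∑-χ-oneToN : ∀ a (Ψ : Fin N → Carrier) →
                 ∑[ m ∈ oneToN ] (χ a m * Ψ (res m)) ≈ ∑[ r ∈ allFin N ] (χ a (Fin.toℕ r) * Ψ r)
    ∑-χ-oneToN a Ψ = trans (∑-cong oneToN (λ m → *-congʳ (sym (χ-res a m)))) (∑-oneToN (λ r → χ a (Fin.toℕ r) * Ψ r))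

    χ-convolution : ∀ a (G : Fin N × Fin N → Carrier) →
      ∑[ m ∈ oneToN ] (χ a m * ∑ (rootPairs (res m)) G) ≈
      ∑[ m₁ ∈ oneToN ] (χ a m₁ * ∑[ m₂ ∈ oneToN ] (χ a m₂ * G (res m₁ , res m₂)))
    χ-convolution a G = begin
      ∑[ m ∈ oneToN ] (χ a m * ∑ (rootPairs (res m)) G)
        ≈⟨ ∑-χ-oneToN a (λ r → ∑ (rootPairs r) G) ⟩
      ∑[ r ∈ Fs ] (χ̂ r * ∑ (rootPairs r) G)
        ≈⟨ ∑-∑-rootPairs χ̂ G ⟩
      ∑[ i ∈ Fs ] ∑[ j ∈ Fs ] (χ̂ (i ⊕ j) * G (i , j))
        ≈⟨ ∑-cong Fs (λ i → ∑-cong Fs (λ j → trans (*-congʳ (χ-⊕ a i j)) (*-assoc _ _ _))) ⟩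
      ∑[ i ∈ Fs ] ∑[ j ∈ Fs ] (χ̂ i * (χ̂ j * G (i , j)))
        ≈⟨ ∑-cong Fs (λ i → *-distribˡ-∑ (χ̂ i) (λ j → χ̂ j * G (i , j)) Fs) ⟨
      ∑[ i ∈ Fs ] (χ̂ i * ∑[ j ∈ Fs ] (χ̂ j * G (i , j)))
        ≈⟨ ∑-χ-oneToN a (λ i → ∑[ j ∈ Fs ] (χ̂ j * G (i , j))) ⟨
      ∑[ m₁ ∈ oneToN ] (χ a m₁ * ∑[ j ∈ Fs ] (χ̂ j * G (res m₁ , j)))
        ≈⟨ ∑-cong oneToN (λ m₁ → *-congˡ (∑-χ-oneToN a (λ j → G (res m₁ , j)))) ⟨
      ∑[ m₁ ∈ oneToN ] (χ a m₁ * ∑[ m₂ ∈ oneToN ] (χ a m₂ * G (res m₁ , res m₂))) ∎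
      where
      Fs = allFin N
      χ̂ : Fin N → Carrier
      χ̂ i = χ a (Fin.toℕ i)

  IsComposition : ℕ → List ℕ → Set
  IsComposition d c = All (1 ℕ.≤_) c × sum c ≡ d

  comps-compositions : ∀ d → All (IsComposition d) (comps d)
  comps-compositions zero    = ([] , ≡.refl) ∷ []
  comps-compositions (suc d) =
    ++⁺ (map⁺ (All.map (λ (pos , Σc) → ℕ.s≤s ℕ.z≤n ∷ pos , ≡.cong suc Σc) (comps-compositions d)))
        (concat⁺ (map⁺ (All.map bump-positive (comps-compositions d))))
    where
    bump-positive : ∀ {c} → IsComposition d c → All (IsComposition (suc d)) (bump c)
    bump-positive {[]}    _                = []
    bump-positive {k ∷ c} (_ ∷ pos , Σc) = (ℕ.s≤s ℕ.z≤n ∷ pos , ≡.cong suc Σc) ∷ []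

  -- Parts of compositions are ≥ 1, whereas letters store k ∸ 1 for y_{k,ζ}.
  ∑-comps-shape : ∀ d s → sum (map suc s) ≡ d → ∑[ c ∈ comps d ] 𝟙 (List.≡-dec ℕ._≟_ s (map (_∸ 1) c)) ≈ 1#
  ∑-comps-shape zero    []          _  = +-identityʳ 1#
  ∑-comps-shape (suc d) (zero ∷ s)  Σs = begin
    ∑ (map (1 ∷_) (comps d) ++ concatMap bump (comps d)) f     ≈⟨ ∑-++ f (map (1 ∷_) (comps d)) _ ⟩
    ∑ (map (1 ∷_) (comps d)) f + ∑ (concatMap bump (comps d)) f
      ≈⟨ +-cong (trans (reflexive (∑-map f (1 ∷_) (comps d))) (∑-comps-shape d s (ℕP.suc-injective Σs)))
                (trans (∑-concatMap f bump (comps d)) (∑-zero-All (comps-compositions d) bump-unshaped)) ⟩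
    1# + 0#                                                     ≈⟨ +-identityʳ 1# ⟩
    1#                                                          ∎
    where
    f : List ℕ → Carrier
    f c = 𝟙 (List.≡-dec ℕ._≟_ (zero ∷ s) (map (_∸ 1) c))
    bump-unshaped : ∀ {c} → IsComposition d c → ∑ (bump c) f ≈ 0#
    bump-unshaped {[]}        _ = refl
    bump-unshaped {suc k ∷ c} _ = +-identityʳ 0#
    bump-unshaped {zero ∷ c}  ((() ∷ _) , _)
  ∑-comps-shape (suc d) (suc k ∷ s) Σs = begin
    ∑ (map (1 ∷_) (comps d) ++ concatMap bump (comps d)) f     ≈⟨ ∑-++ f (map (1 ∷_) (comps d)) _ ⟩
    ∑ (map (1 ∷_) (comps d)) f + ∑ (concatMap bump (comps d)) f
      ≈⟨ +-cong (trans (reflexive (∑-map f (1 ∷_) (comps d))) (∑-zero (comps d) (λ _ → refl)))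
                (trans (∑-concatMap f bump (comps d))
                       (trans (∑-cong-All (comps-compositions d) bump-shaped)
                              (∑-comps-shape d (k ∷ s) (ℕP.suc-injective Σs)))) ⟩
    0# + 1#                                                     ≈⟨ +-identityˡ 1# ⟩
    1#                                                          ∎
    where
    f : List ℕ → Carrier
    f c = 𝟙 (List.≡-dec ℕ._≟_ (suc k ∷ s) (map (_∸ 1) c))
    bump-shaped : ∀ {c} → IsComposition d c → ∑ (bump c) f ≈ 𝟙 (List.≡-dec ℕ._≟_ (k ∷ s) (map (_∸ 1) c))
    bump-shaped {[]}         _ = refl
    bump-shaped {suc k' ∷ c} _ = +-identityʳ _
    bump-shaped {zero ∷ c}   ((() ∷ _) , _)

  module RootLetters {L : Set} (_≟_ : DecidableEquality L) (letter : ℕ → Fin N → L) (index : L → ℕ × Fin N)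
                     (letter-index : ∀ l → letter (proj₁ (index l)) (proj₂ (index l)) ≡ l)
                     (index-letter : ∀ k m → index (letter k m) ≡ (k , m))
                     (weight : List L → ℕ) (weight-[] : weight [] ≡ 0)
                     (weight-∷ : ∀ l w → weight (l ∷ w) ≡ suc (proj₁ (index l)) ℕ.+ weight w) where

    shape : List L → List ℕ
    shape = map (λ l → proj₁ (index l))

    weight-shape : ∀ w → weight w ≡ sum (map suc (shape w))
    weight-shape []      = weight-[]
    weight-shape (l ∷ w) = ≡.trans (weight-∷ l w) (≡.cong (suc (proj₁ (index l)) ℕ.+_) (weight-shape w))

    weight-++ : ∀ u v → weight (u ++ v) ≡ weight u ℕ.+ weight v
    weight-++ []      v = ≡.cong (ℕ._+ weight v) (≡.sym weight-[])
    weight-++ (l ∷ u) v =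
      ≡.trans (weight-∷ l (u ++ v)) (≡.trans (≡.cong (suc (proj₁ (index l)) ℕ.+_) (weight-++ u v))
        (≡.trans (≡.sym (ℕP.+-assoc (suc (proj₁ (index l))) (weight u) (weight v)))
                 (≡.cong (ℕ._+ weight v) (≡.sym (weight-∷ l u)))))

    letter-multiplicity : ∀ l k → Multiplicity _≟_ (map (letter k) (allFin N)) l (𝟙 (proj₁ (index l) ℕ.≟ k))
    letter-multiplicity l k = multiplicity-by (proj₁ (index l) ℕ.≟ k)
      where
      multiplicity-by : (k? : Dec (proj₁ (index l) ≡ k)) → Multiplicity _≟_ (map (letter k) (allFin N)) l (𝟙 k?)
      multiplicity-by (yes ≡.refl) = ≡.subst (λ l' → Multiplicity _≟_ (map (letter k) (allFin N)) l' 1#) (letter-index l)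
        (multiplicity-map Fin._≟_ _≟_ letter-injective (allFin N) (allFin-once N (proj₂ (index l))))
        where
        letter-injective : ∀ {m m'} → letter k m ≡ letter k m' → m ≡ m'
        letter-injective {m} {m'} eq =
          ≡.cong proj₂ (≡.trans (≡.sym (index-letter k m)) (≡.trans (≡.cong index eq) (index-letter k m')))
      multiplicity-by (no k≢) = multiplicity-absent _≟_
        (map⁺ (All.universal (λ m l≡ → k≢ (≡.cong proj₁ (≡.trans (≡.cong index l≡) (index-letter k m)))) (allFin N)))

    wordsComp-multiplicity : ∀ c x → Multiplicity (List.≡-dec _≟_) (wordsComp letter c) x
                                                  (𝟙 (List.≡-dec ℕ._≟_ (shape x) (map (_∸ 1) c)))
    wordsComp-multiplicity []      []      = multiplicity-cong _ (+-identityʳ 1#) (multiplicity-∷ _ [] [] (multiplicity-absent _ []))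
    wordsComp-multiplicity []      (l ∷ x) = multiplicity-cong _ (+-identityʳ 0#) (multiplicity-∷ _ [] [] (multiplicity-absent _ []))
    wordsComp-multiplicity (k ∷ c) x       = ≡.subst (λ W → Multiplicity (List.≡-dec _≟_) W x _)
      (List.concatMap-map (λ b → map (b ∷_) (wordsComp letter c)) (letter (k ∸ 1)) (allFin N)) (cons x)
      where
      cons : ∀ x → Multiplicity (List.≡-dec _≟_) (prefixEach (map (letter (k ∸ 1)) (allFin N)) (wordsComp letter c)) x
                                 (𝟙 (List.≡-dec ℕ._≟_ (shape x) (map (_∸ 1) (k ∷ c))))
      cons []      = multiplicity-prefixEach-[] _≟_ (map (letter (k ∸ 1)) (allFin N)) (wordsComp letter c)
      cons (l ∷ x) = multiplicity-cong _ (sym (𝟙-∷ ℕ._≟_ (proj₁ (index l)) (k ∸ 1) (shape x) (map (_∸ 1) c)))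
        (multiplicity-prefixEach _≟_ {L = map (letter (k ∸ 1)) (allFin N)} {W = wordsComp letter c}
          (letter-multiplicity l (k ∸ 1)) (wordsComp-multiplicity c x))

    wordsComp-weight : ∀ c → All (1 ℕ.≤_) c → All (λ w → weight w ≡ sum c) (wordsComp letter c)
    wordsComp-weight []      []                   = weight-[] ∷ []
    wordsComp-weight (suc k ∷ c) (ℕ.s≤s ℕ.z≤n ∷ pos) = concat⁺ (map⁺ (All.universal (λ m → map⁺
      (All.map (λ {w} eq → ≡.trans (weight-∷ (letter k m) w)
                                   (≡.cong₂ (λ i j → suc i ℕ.+ j) (≡.cong proj₁ (index-letter k m)) eq))
               (wordsComp-weight c pos))) (allFin N)))

    wordsWt-weight : ∀ d → All (λ w → weight w ≡ d) (wordsWt letter d)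
    wordsWt-weight d = concat⁺ (map⁺ (All.map (λ (pos , Σc) → All.map (λ eq → ≡.trans eq Σc) (wordsComp-weight _ pos))
                                              (comps-compositions d)))

    wordsWt-once : ∀ {d} x → weight x ≡ d → OccursOnce (List.≡-dec _≟_) x (wordsWt letter d)
    wordsWt-once {d} x x∈d = multiplicity λ g → begin
      ∑[ w ∈ concatMap (wordsComp letter) (comps d) ] (𝟙 (x ≟ʷ w) * g w)
        ≈⟨ ∑-concatMap _ (wordsComp letter) (comps d) ⟩
      ∑[ c ∈ comps d ] ∑[ w ∈ wordsComp letter c ] (𝟙 (x ≟ʷ w) * g w)
        ≈⟨ ∑-cong (comps d) (λ c → sifts (wordsComp-multiplicity c x) g) ⟩
      ∑[ c ∈ comps d ] (𝟙 (List.≡-dec ℕ._≟_ (shape x) (map (_∸ 1) c)) * g x)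
        ≈⟨ *-distribʳ-∑ (g x) (λ c → 𝟙 (List.≡-dec ℕ._≟_ (shape x) (map (_∸ 1) c))) (comps d) ⟨
      ∑[ c ∈ comps d ] 𝟙 (List.≡-dec ℕ._≟_ (shape x) (map (_∸ 1) c)) * g x
        ≈⟨ *-congʳ (∑-comps-shape d (shape x) (≡.trans (≡.sym (weight-shape x)) x∈d)) ⟩
      1# * g x ∎
      where
      _≟ʷ_ = List.≡-dec _≟_

    graded : GradedAlphabet L
    graded = record
      { _≟_          = _≟_
      ; weight       = weight
      ; weight-[]    = weight-[]
      ; weight-++    = weight-++
      ; words        = wordsWt letter
      ; words-weight = wordsWt-weight
      ; words-once   = wordsWt-once
      }

  indexY : LY → ℕ × Fin N
  indexY (y k m) = k , m

  y-indexY : ∀ l → y (proj₁ (indexY l)) (proj₂ (indexY l)) ≡ l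
  y-indexY (y k m) = ≡.refl

  wtY-∷ : ∀ l w → wtY (l ∷ w) ≡ suc (proj₁ (indexY l)) ℕ.+ wtY w
  wtY-∷ (y k m) w = ≡.refl

  indexỸ : LỸ → ℕ × Fin N
  indexỸ (ỹ k α) = k , α

  ỹ-indexỸ : ∀ l → ỹ (proj₁ (indexỸ l)) (proj₂ (indexỸ l)) ≡ l
  ỹ-indexỸ (ỹ k α) = ≡.refl

  wtỸ-∷ : ∀ l w → wtỸ (l ∷ w) ≡ suc (proj₁ (indexỸ l)) ℕ.+ wtỸ w
  wtỸ-∷ (ỹ k α) w = ≡.refl

  module Y = RootLetters _≟Y_ y indexY y-indexY (λ k m → ≡.refl) wtY ≡.refl wtY-∷
  module Ỹ = RootLetters _≟Ỹ_ ỹ indexỸ ỹ-indexỸ (λ k α → ≡.refl) wtỸ ≡.refl wtỸ-∷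

  module Stuffle (ζ^N≈1 : pow ζ N ≈ 1#) where
    open Characters ζ^N≈1
    open Intertwining K σFY σSt̃ σSt

    Δ*-extra : ℕ → Fin N → LinComb (List LY × List LY)
    Δ*-extra k r =
      concatMap (λ s → map (λ t → (1# , y (proj₁ s) (proj₁ t) ∷ [] , y (proj₂ s) (proj₂ t) ∷ [])) (rootPairs r)) (splits k)

    Δ*̃-extra : ℕ → Fin N → LinComb (List LỸ × List LỸ)
    Δ*̃-extra k α = map (λ s → (1# , ỹ (proj₁ s) α ∷ [] , ỹ (proj₂ s) α ∷ [])) (splits k)

    Δ*-extra-intertwines : ∀ k α h →
      ∑[ m ∈ oneToN ] (χ (ιinv α) m * ⟨ h ∣ Δ*-extra k (res m) ⟩) ≈ ⟨ F⊗Fᵀ h ∣ Δ*̃-extra k α ⟩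
    Δ*-extra-intertwines k α h = begin
      ∑[ m ∈ oneToN ] (χ a m * ⟨ h ∣ Δ*-extra k (res m) ⟩)
        ≈⟨ ∑-cong oneToN (λ m → trans (*-congˡ (pairing-extra (res m))) (*-distribˡ-∑ (χ a m) _ (splits k))) ⟩
      ∑[ m ∈ oneToN ] ∑[ s ∈ splits k ] (χ a m * ∑ (rootPairs (res m)) (G s))
        ≈⟨ ∑-comm (λ m s → χ a m * ∑ (rootPairs (res m)) (G s)) oneToN (splits k) ⟩
      ∑[ s ∈ splits k ] ∑[ m ∈ oneToN ] (χ a m * ∑ (rootPairs (res m)) (G s))
        ≈⟨ ∑-cong (splits k) (λ s → trans (χ-convolution a (G s)) (per-split s)) ⟩
      ∑[ s ∈ splits k ] (1# * F⊗Fᵀ h (ỹ (proj₁ s) α ∷ [] , ỹ (proj₂ s) α ∷ []))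
        ≡⟨ ∑-map _ _ (splits k) ⟨
      ⟨ F⊗Fᵀ h ∣ Δ*̃-extra k α ⟩ ∎
      where
      a = ιinv α
      G : ℕ × ℕ → Fin N × Fin N → Carrier
      G s t = 1# * h (y (proj₁ s) (proj₁ t) ∷ [] , y (proj₂ s) (proj₂ t) ∷ [])
      pairing-extra : ∀ r → ⟨ h ∣ Δ*-extra k r ⟩ ≈ ∑[ s ∈ splits k ] ∑ (rootPairs r) (G s)
      pairing-extra r = trans (∑-concatMap _ _ (splits k)) (∑-cong (splits k) (λ s → reflexive (∑-map _ _ (rootPairs r))))
      per-split : ∀ s → ∑[ m₁ ∈ oneToN ] (χ a m₁ * ∑[ m₂ ∈ oneToN ] (χ a m₂ * G s (res m₁ , res m₂)))
                        ≈ 1# * F⊗Fᵀ h (ỹ (proj₁ s) α ∷ [] , ỹ (proj₂ s) α ∷ [])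
      per-split (k₁ , k₂) = begin
        ∑[ m₁ ∈ oneToN ] (χ a m₁ * ∑[ m₂ ∈ oneToN ] (χ a m₂ * (1# * h (y k₁ (res m₁) ∷ [] , y k₂ (res m₂) ∷ []))))
          ≈⟨ ∑-cong oneToN (λ m₁ → *-congˡ (∑-cong oneToN (λ m₂ → *-congˡ (*-identityˡ _)))) ⟩
        ∑[ m₁ ∈ oneToN ] (χ a m₁ * ∑[ m₂ ∈ oneToN ] (χ a m₂ * h (y k₁ (res m₁) ∷ [] , y k₂ (res m₂) ∷ [])))
          ≈⟨ ∑-cong oneToN (λ m₁ → *-congˡ (reflexive
               (⟨⟩-letters (λ w' → h (y k₁ (res m₁) ∷ [] , w')) oneToN (χ a) (λ m → y k₂ (res m))))) ⟨
        ∑[ m₁ ∈ oneToN ] (χ a m₁ * ⟨ (λ w' → h (y k₁ (res m₁) ∷ [] , w')) ∣ σFY (ỹ k₂ α) ⟩)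
          ≡⟨ ⟨⟩-letters (λ w → ⟨ (λ w' → h (w , w')) ∣ σFY (ỹ k₂ α) ⟩) oneToN (χ a) (λ m → y k₁ (res m)) ⟨
        ⟨ (λ w → ⟨ (λ w' → h (w , w')) ∣ σFY (ỹ k₂ α) ⟩) ∣ σFY (ỹ k₁ α) ⟩
          ≈⟨ F⊗Fᵀ-letter h (ỹ k₁ α) (ỹ k₂ α) ⟨
        F⊗Fᵀ h (ỹ k₁ α ∷ [] , ỹ k₂ α ∷ [])
          ≈⟨ *-identityˡ _ ⟨
        1# * F⊗Fᵀ h (ỹ k₁ α ∷ [] , ỹ k₂ α ∷ []) ∎

    σFY-intertwines : ∀ a → Intertwines (σFY a) (σSt̃ a)
    σFY-intertwines (ỹ k α) h = begin
      ⟨ (λ w → ⟨ h ∣ ΔB w ⟩) ∣ σFY (ỹ k α) ⟩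
        ≈⟨ ΔB-letters h oneToN (χ a) letter ⟩
      ∑[ m ∈ oneToN ] (χ a m * ⟨ h ∣ prim (letter m ∷ []) ++ Δ*-extra k (res m) ⟩)
        ≈⟨ ∑-cong oneToN (λ m → trans (*-congˡ (∑-++ _ (prim (letter m ∷ [])) (Δ*-extra k (res m)))) (distribˡ _ _ _)) ⟩
      ∑[ m ∈ oneToN ] (χ a m * ⟨ h ∣ prim (letter m ∷ []) ⟩ + χ a m * ⟨ h ∣ Δ*-extra k (res m) ⟩)
        ≈⟨ ∑-distrib-+ _ _ oneToN ⟩
      ∑[ m ∈ oneToN ] (χ a m * ⟨ h ∣ prim (letter m ∷ []) ⟩) +
      ∑[ m ∈ oneToN ] (χ a m * ⟨ h ∣ Δ*-extra k (res m) ⟩)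
        ≈⟨ +-cong (reflexive (≡.sym (⟨⟩-letters (λ w → ⟨ h ∣ prim w ⟩) oneToN (χ a) letter)))
                  (Δ*-extra-intertwines k α h) ⟩
      ⟨ (λ w → ⟨ h ∣ prim w ⟩) ∣ σFY (ỹ k α) ⟩ + ⟨ F⊗Fᵀ h ∣ Δ*̃-extra k α ⟩
        ≈⟨ +-congʳ (F⊗Fᵀ-prim h (ỹ k α)) ⟨
      ⟨ F⊗Fᵀ h ∣ prim (ỹ k α ∷ []) ⟩ + ⟨ F⊗Fᵀ h ∣ Δ*̃-extra k α ⟩
        ≈⟨ ∑-++ _ (prim (ỹ k α ∷ [])) (Δ*̃-extra k α) ⟨
      ⟨ F⊗Fᵀ h ∣ σSt̃ (ỹ k α) ⟩ ∎
      where
      a = ιinv α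
      letter : ℕ → LY
      letter m = y k (res m)

    σFY-homogeneous : ∀ a → Homogeneous wtY (wtỸ (a ∷ [])) (σFY a)
    σFY-homogeneous (ỹ k α) = map⁺ (All.universal (λ _ → ≡.refl) oneToN)

    stuffle-compatible : (S : Series LỸ) (u v : List LY) → Δ* (𝓕Y S) u v ≈ 𝓕Y⊗𝓕Y (Δ*̃ S) u v
    stuffle-compatible = 𝓕ˢ-preserves-coproduct σFY-homogeneous σFY-intertwines
      where open SeriesTransfer K Ỹ.graded Y.graded σFY σSt̃ σSt

lemma3p4 : ∀ {c ℓ} (K : CommutativeRing c ℓ) (n : ℕ) (ζ : CommutativeRing.Carrier K) →
           let open CommutativeRing K
               open Hopf K n ζ
           in IsPrimitiveRoot →
              ((S : Series LX̃) (u v : List LX) → Δш (𝓕 S) u v ≈ 𝓕⊗𝓕 (Δш̃ S) u v)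
              × ((S : Series LỸ) (u v : List LY) → Δ* (𝓕Y S) u v ≈ 𝓕Y⊗𝓕Y (Δ*̃ S) u v)
lemma3p4 K n ζ (ζ^N≈1 , _) =
  FourierTransform.Shuffle.shuffle-compatible K n ζ , FourierTransform.Stuffle.stuffle-compatible K n ζ ζ^N≈1
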